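{- Let $k\ge3$, $C>0$, let $B$ be a bipartite graph with left vertex set $I$ and right vertex set $J$, every left vertex of degree exactly $k$ and every right vertex of degree at most $Ck$, and let $G=G(B)$ be the graph described below. Let $\mathbb{F}$ be a field. If the $k$-colouring equations of $G$ have a polynomial calculus refutation over $\mathbb{F}$ of degree $d$, then the functional pigeonhole equations of $B$ have a polynomial calculus refutation over $\mathbb{F}$ of degree at most $2d$.
   Context: Construction of $G(B)$: for each $i\in I$ fix an enumeration of its $k$ incident edges by $1,\dots,k$. For $c,c'\in[k]$, the gadget $H(i,i',c,c')$ consists of the vertices $i,i'$, two disjoint $k$-cliques $\ell_1,\dots,\ell_k$ and $r_1,\dots,r_k$, the edges $\{i,\ell_1\}$ and $\{i',r_1\}$, a new vertex pre-coloured $c$ adjacent to $\ell_2,\dots,\ell_{k-1}$, a new vertex pre-coloured $c'$ adjacent to $r_2,\dots,r_{k-1}$, and the edge $\{\ell_k,r_k\}$ if $c=c'$, or, if $c\ne c'$, $\ell_k$ and $r_k$ identified into one vertex. $\widehat{G}(B)$ is the union of all gadgets $H(i,i',c,c')$ over distinct $i\ne i'\in I$ and $c,c'\in[k]$ such that the $c$th edge of $i$ and the $c'$th edge of $i'$ end in the same vertex of $J$; pigeon vertices are shared, all other gadget vertices are distinct. Then take new vertices $z_1,\dots,z_M$ with $M=O(k^3|I|)$ large enough, make every $k$ consecutive ones $z_t,\dots,z_{t+k-1}$ a $k$-clique, identify each vertex of $\widehat G$ pre-coloured $c$ with the first not-yet-used $z_t$ with $t\equiv c\pmod k$, and drop the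 pre-colourings; the result is $G(B)$. The $k$-colouring equations of a graph $G=(V,E)$ over $\{0,1\}$-valued variables $x_{v,j}$: $\sum_{j=1}^k x_{v,j}-1$ ($v\in V$); $x_{v,j}x_{v,j'}$ ($v\in V$, $j\ne j'$); $x_{u,j}x_{v,j}$ ($(u,v)\in E$, $j\in[k]$). The functional pigeonhole equations of $B$ over variables $p_{i,j}$ ($i\in I$, $j\in N(i)$, the neighbourhood of $i$ in $B$): $\sum_{j\in N(i)}p_{i,j}-1$ ($i\in I$); $p_{i,j}p_{i,j'}$ ($i\in I$, $j\ne j'\in N(i)$); $p_{i,j}p_{i',j}$ ($i\ne i'$, $j\in N(i)\cap N(i')$). Polynomial calculus over $\mathbb{F}$: lines are Boolean axioms $x^2-x$, input polynomials, linear combinations of earlier lines with coefficients in $\mathbb{F}$, or products $x\cdot p$ of an earlier line $p$ with a variable $x$; a refutation derives $1$; degree is the maximal total degree of a line. -}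

module Defs where

open import Level using (Level; _⊔_) renaming (suc to lsuc)
open import Data.Bool using (Bool; true; false; _∧_; _∨_; not; T; if_then_else_)
open import Data.Unit using (tt)
open import Data.Nat as ℕ using (ℕ; zero; suc; _<_; _≤_; _∸_)
open import Data.Fin as Fin using (Fin; toℕ)
open import Data.Fin.Properties using () renaming (_≟_ to _≟F_)
open import Data.List using (List; []; _∷_; _++_; map; length; allFin; concatMap)
open import Data.Maybe using (Maybe; just; nothing)
open import Data.Product using (Σ; ∃; _×_; _,_; proj₁; proj₂)
open import Data.Product.Properties using (≡-dec)
open import Relation.Nullary using (¬_; yes; no; does)
open import Relation.Binary.PropositionalEquality using (_≡_; _≢_; refl; cong)
open import Relation.Binary.Definitions using (DecidableEquality)
open import Algebra.Bundles using (CommutativeRing)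

decPair : ∀ {A B : Set} → DecidableEquality A → DecidableEquality B → DecidableEquality (A × B)
decPair {A} {B} dA dB = ≡-dec {B = λ _ → B} dA dB

decFin : ∀ n → DecidableEquality (Fin n)
decFin n = _≟F_

record Field (c ℓ : Level) : Set (lsuc (c ⊔ ℓ)) where
  field
    commutativeRing : CommutativeRing c ℓ
  open CommutativeRing commutativeRing public
  field
    1≉0     : ¬ (1# ≈ 0#)
    inverse : ∀ x → ¬ (x ≈ 0#) → ∃ λ y → (x * y) ≈ 1#

-- A monomial is a finite multiset of variables, represented by a list
-- (order irrelevant; two lists denote the same monomial iff they are
-- permutations of each other, tested by 'sameBag').  Two representations denote the same
-- polynomial iff all coefficients agree ('_≈ₚ_').

module Poly {c ℓ} (F : Field c ℓ) {X : Set} (_≟X_ : DecidableEquality X) where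
  open Field F

  Mono : Set
  Mono = List X

  Pol : Set c
  Pol = List (Carrier × Mono)

  removeOne : X → List X → Maybe (List X)
  removeOne x [] = nothing
  removeOne x (y ∷ ys) with does (x ≟X y)
  ... | true  = just ys
  ... | false with removeOne x ys
  ...   | just ys′ = just (y ∷ ys′)
  ...   | nothing  = nothing

  sameBag : Mono → Mono → Bool
  sameBag [] []      = true
  sameBag [] (_ ∷ _) = false
  sameBag (x ∷ xs) ys with removeOne x ys
  ... | just ys′ = sameBag xs ys′
  ... | nothing  = false

  coeff : Pol → Mono → Carrier
  coeff [] m             = 0#
  coeff ((a , m′) ∷ p) m = (if sameBag m′ m then a else 0#) + coeff p m

  _≈ₚ_ : Pol → Pol → Set ℓ
  p ≈ₚ q = ∀ m → coeff p m ≈ coeff q m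

  DegLe : ℕ → Pol → Set ℓ
  DegLe d p = ∀ m → d < length m → coeff p m ≈ 0#

  constP : Carrier → Pol
  constP a = (a , []) ∷ []

  oneP : Pol
  oneP = constP 1#

  linComb : Carrier → Pol → Carrier → Pol → Pol
  linComb a p b q = map (λ t → (a * proj₁ t , proj₂ t)) p
                 ++ map (λ t → (b * proj₁ t , proj₂ t)) q

  mulVar : X → Pol → Pol
  mulVar x p = map (λ t → (proj₁ t , x ∷ proj₂ t)) p

  booleanAxiom : X → Pol
  booleanAxiom x = (1# , x ∷ x ∷ []) ∷ (- 1# , x ∷ []) ∷ []

  data Derivable {a} (Ax : Pol → Set a) (d : ℕ) : Pol → Set (c ⊔ ℓ ⊔ a) where
    boolean : ∀ x → DegLe d (booleanAxiom x) → Derivable Ax d (booleanAxiom x)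
    input   : ∀ {p} → Ax p → DegLe d p → Derivable Ax d p
    lin     : ∀ {p q} (a b : Carrier) → Derivable Ax d p → Derivable Ax d q →
              DegLe d (linComb a p b q) → Derivable Ax d (linComb a p b q)
    mul     : ∀ {p} (x : X) → Derivable Ax d p → DegLe d (mulVar x p) →
              Derivable Ax d (mulVar x p)

  Refutation : ∀ {a} → (Pol → Set a) → ℕ → Set (c ⊔ ℓ ⊔ a)
  Refutation Ax d = ∃ λ p → Derivable Ax d p × (p ≈ₚ oneP)

module Colouring {c ℓ} (F : Field c ℓ) (k : ℕ)
                 {V : Set} (_≟V_ : DecidableEquality V) (Edge : V → V → Set) where
  open Field F using (1#; -_)
  open Poly F (decPair _≟V_ (decFin k)) public

  data KColEq : Pol → Set where
    sumOne : ∀ v → KColEq (map (λ j → (1# , (v , j) ∷ [])) (allFin k) ++ constP (- 1#))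
    atMost : ∀ v j j′ → j ≢ j′ → KColEq ((1# , (v , j) ∷ (v , j′) ∷ []) ∷ [])
    edge   : ∀ u v j → Edge u v → KColEq ((1# , (u , j) ∷ (v , j) ∷ []) ∷ [])

KColouringRefutation : ∀ {c ℓ} → Field c ℓ → (k : ℕ) → (V : Set) →
  DecidableEquality V → (V → V → Set) → ℕ → Set (c ⊔ ℓ)
KColouringRefutation F k V _≟V_ Edge d =
  Colouring.Refutation F k _≟V_ Edge (Colouring.KColEq F k _≟V_ Edge) d

-- Bipartite graphs B with left vertices I = Fin nI, right vertices
-- J = Fin nJ, every left vertex of degree exactly k, given together with
-- the enumeration of the edges at each left vertex: nbr i c is the right
-- end of the c-th edge of i (nbr i injective, so N(i) = image of nbr i).

rightDegree : ∀ {nI nJ k} → (Fin nI → Fin k → Fin nJ) → Fin nJ → ℕ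
rightDegree {nI} {nJ} {k} nbr j =
  length (Data.List.filterᵇ (λ i → Data.Bool.ListAction.any (λ c → does (nbr i c ≟F j)) (allFin k)) (allFin nI))
  where import Data.List; import Data.Bool.ListAction

-- Functional pigeonhole equations of B.  The variable p_{i,j}
-- (j ∈ N(i)) is indexed by (i , c) with j = nbr i c.
module FPHP {c ℓ} (F : Field c ℓ) {nI nJ k : ℕ} (nbr : Fin nI → Fin k → Fin nJ) where
  open Field F using (1#; -_)
  open Poly F (decPair (decFin nI) (decFin k)) public

  data FPHPEq : Pol → Set where
    pigeon : ∀ i → FPHPEq (map (λ c → (1# , (i , c) ∷ [])) (allFin k) ++ constP (- 1#))
    func   : ∀ i c c′ → c ≢ c′ → FPHPEq ((1# , (i , c) ∷ (i , c′) ∷ []) ∷ [])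
    hole   : ∀ i i′ c c′ → i ≢ i′ → nbr i c ≡ nbr i′ c′ →
             FPHPEq ((1# , (i , c) ∷ (i′ , c′) ∷ []) ∷ [])

FPHPRefutation : ∀ {c ℓ} → Field c ℓ → ∀ {nI nJ k} → (Fin nI → Fin k → Fin nJ) → ℕ → Set (c ⊔ ℓ)
FPHPRefutation F nbr d = FPHP.Refutation F nbr (FPHP.FPHPEq F nbr) d

-- A gadget index is (i , i′ , c , c′) with
-- colours c, c′ ∈ Fin k (0-based: colour c here is colour c+1 of the
-- paper).  Each gadget has two pre-coloured vertices: side L (colour c,
-- adjacent to ℓ_2..ℓ_{k-1}) and side R (colour c′, adjacent to r_2..r_{k-1}).

module GadgetIndex (nI k : ℕ) where
  Gad : Set
  Gad = Fin nI × Fin nI × Fin k × Fin k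

  gi gi′ : Gad → Fin nI
  gi  (i , _ , _ , _) = i
  gi′ (_ , i′ , _ , _) = i′
  gc gc′ : Gad → Fin k
  gc  (_ , _ , c , _) = c
  gc′ (_ , _ , _ , c′) = c′

  data Side : Set where
    L R : Side

  PV : Set
  PV = Gad × Side

  colourOf : PV → Fin k
  colourOf (g , L) = gc g
  colourOf (g , R) = gc′ g

  allGad : List Gad
  allGad = concatMap (λ i → concatMap (λ i′ → concatMap (λ c →
             map (λ c′ → (i , i′ , c , c′)) (allFin k)) (allFin k)) (allFin nI)) (allFin nI)

  allPV : List PV
  allPV = concatMap (λ g → (g , L) ∷ (g , R) ∷ []) allGad

-- M     : number of the vertices z_1..z_M (here zv t, t : Fin M, is z_{t+1})
--   key   : an injective key fixing the order in which the pre-coloured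
--           vertices are processed ("first not-yet-used z_t"): pre-coloured
--           vertices are processed in increasing key order.

module Construction (k nI nJ : ℕ) (nbr : Fin nI → Fin k → Fin nJ)
                    (M : ℕ) (key : GadgetIndex.PV nI k → ℕ) where
  open GadgetIndex nI k public

  validG : Gad → Bool
  validG g = not (does (gi g ≟F gi′ g)) ∧ does (nbr (gi g) (gc g) ≟F nbr (gi′ g) (gc′ g))

  countᵇ : ∀ {A : Set} → (A → Bool) → List A → ℕ
  countᵇ p []       = 0
  countᵇ p (x ∷ xs) = (if p x then 1 else 0) ℕ.+ countᵇ p xs

  rank : PV → ℕ
  rank v = countᵇ (λ w → validG (proj₁ w) ∧ (key w ℕ.<ᵇ key v)
                          ∧ does (colourOf w ≟F colourOf v)) allPV

  -- 0-based index of the z-vertex that v is identified with: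
  -- the (rank v + 1)-th index t ≡ colour (mod k), i.e. z_{c + k·rank}
  zIndex : PV → ℕ
  zIndex v = toℕ (colourOf v) ℕ.+ k ℕ.* rank v

  Enough : Set
  Enough = ∀ v → T (validG (proj₁ v)) → zIndex v < M

  -- vertices (before restricting to the valid ones):
  --   pig i    : pigeon vertex i ∈ I
  --   lv g a   : ℓ_{a+1} of gadget g
  --   rv g a   : r_{a+1} of gadget g
  --   zv t     : z_{t+1}
  data Pre : Set where
    pig : Fin nI → Pre
    lv  : Gad → Fin k → Pre
    rv  : Gad → Fin k → Pre
    zv  : Fin M → Pre

  isLast : Fin k → Bool
  isLast a = does (toℕ a ℕ.≟ (k ∸ 1))

  -- r_k exists as its own vertex only if c = c′ (otherwise r_k = ℓ_k)
  validP : Pre → Bool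
  validP (pig _)  = true
  validP (lv g _) = validG g
  validP (rv g a) = validG g ∧ (not (isLast a) ∨ does (gc g ≟F gc′ g))
  validP (zv _)   = true

  V : Set
  V = Σ Pre (λ v → T (validP v))

  Lv : Gad → Fin k → Pre
  Lv g a = lv g a
  Rv : Gad → Fin k → Pre
  Rv g a = if isLast a ∧ not (does (gc g ≟F gc′ g)) then lv g a else rv g a

  data EdgeP : Pre → Pre → Set where
    ℓℓ : ∀ g a b → T (validG g) → a ≢ b → EdgeP (Lv g a) (Lv g b)
    rr : ∀ g a b → T (validG g) → a ≢ b → EdgeP (Rv g a) (Rv g b)
    iℓ : ∀ g a → T (validG g) → toℕ a ≡ 0 → EdgeP (pig (gi g)) (Lv g a)
    ir : ∀ g a → T (validG g) → toℕ a ≡ 0 → EdgeP (pig (gi′ g)) (Rv g a)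
    pℓ : ∀ g a (t : Fin M) → T (validG g) → 1 ≤ toℕ a → toℕ a ≤ k ∸ 2 →
         toℕ t ≡ zIndex (g , L) → EdgeP (zv t) (Lv g a)
    pr : ∀ g a (t : Fin M) → T (validG g) → 1 ≤ toℕ a → toℕ a ≤ k ∸ 2 →
         toℕ t ≡ zIndex (g , R) → EdgeP (zv t) (Rv g a)
    ℓr : ∀ g a → T (validG g) → toℕ a ≡ k ∸ 1 → gc g ≡ gc′ g → EdgeP (Lv g a) (Rv g a)
    zz : ∀ (s t : Fin M) → s ≢ t →
         (∃ λ w → w ≤ toℕ s × w ≤ toℕ t × toℕ s < w ℕ.+ k × toℕ t < w ℕ.+ k × w ℕ.+ k ≤ M) →
         EdgeP (zv s) (zv t)
    symm : ∀ {u v} → EdgeP u v → EdgeP v u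

  Edge : V → V → Set
  Edge u v = EdgeP (proj₁ u) (proj₁ v)

  _≟P_ : DecidableEquality Pre
  pig i ≟P pig j with i ≟F j
  ... | yes refl = yes refl
  ... | no ne    = no λ { refl → ne refl }
  pig _ ≟P lv _ _ = no λ ()
  pig _ ≟P rv _ _ = no λ ()
  pig _ ≟P zv _   = no λ ()
  lv _ _ ≟P pig _ = no λ ()
  lv g a ≟P lv h b with decPair (decPair (decFin nI) (decPair (decFin nI) (decPair (decFin k) (decFin k)))) (decFin k) (g , a) (h , b)
  ... | yes refl = yes refl
  ... | no ne    = no λ { refl → ne refl }
  lv _ _ ≟P rv _ _ = no λ ()
  lv _ _ ≟P zv _   = no λ ()
  rv _ _ ≟P pig _  = no λ ()
  rv _ _ ≟P lv _ _ = no λ ()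
  rv g a ≟P rv h b with decPair (decPair (decFin nI) (decPair (decFin nI) (decPair (decFin k) (decFin k)))) (decFin k) (g , a) (h , b)
  ... | yes refl = yes refl
  ... | no ne    = no λ { refl → ne refl }
  rv _ _ ≟P zv _   = no λ ()
  zv _ ≟P pig _    = no λ ()
  zv _ ≟P lv _ _   = no λ ()
  zv _ ≟P rv _ _   = no λ ()
  zv s ≟P zv t with s ≟F t
  ... | yes refl = yes refl
  ... | no ne    = no λ { refl → ne refl }

  T-irr : ∀ b (p q : T b) → p ≡ q
  T-irr true _ _ = refl

  _≟V_ : DecidableEquality V
  (u , p) ≟V (v , q) with u ≟P v
  ... | yes refl = yes (cong (u ,_) (T-irr (validP u) p q))
  ... | no ne    = no λ eq → ne (cong proj₁ eq)

{-# OPTIONS --safe #-}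
module Submission where

-- Substitute for each colouring variable x_{v,j} a polynomial of degree at most 2 in the
-- pigeon variables saying "v gets colour j" in a colouring of G(B) read off from the
-- pigeons' choices.  Pigeon i gets the index of its chosen edge and z_t the colour t mod k;
-- a vertex of the gadget H(i,i′,c,c′) gets a colour depending only on the choices x of i
-- and y of i′, so its polynomial is a sum of products p_{i,x} p_{i′,y}.  The gadget
-- colouring is proper unless x = c and y = c′, and then i and i′ collide in a hole.  Hence
-- the axiom Σ_j x_{v,j} − 1 maps to a consequence of the pigeon axioms, every other
-- colouring axiom to a sum of terms with coefficient 0 or divisible by a functional or hole
-- axiom, and every Boolean axiom to a consequence of Boolean axioms, all in degree 4.  The
-- substitution commutes with linear combinations and turns multiplication by a variable
-- into multiplication by a polynomial of degree 2, so, after dropping the vanishing terms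
-- above degree d, a degree-d refutation becomes a degree-2d one.

open import Defs
open import Level using (Level; _⊔_)
open import Function using (_∘_)
open import Data.Bool using (Bool; true; false; if_then_else_; T; not; _∧_)
open import Data.Nat as ℕ using (ℕ; zero; suc; _<_; _≤_; z≤n; s≤s)
import Data.Nat.Properties as ℕP
open import Data.Fin using (Fin; zero; suc; toℕ; fromℕ)
open import Data.Fin.Properties using (toℕ-fromℕ; toℕ-injective) renaming (_≟_ to _≟F_)
open import Data.List using (List; []; _∷_; _++_; map; length; concatMap; filterᵇ; allFin; tabulate; foldr)
import Data.List.Properties as ListP
open import Data.Maybe using (just; nothing)
open import Data.Product using (∃; _×_; _,_; proj₁; proj₂)
open import Data.Sum using (_⊎_; inj₁; inj₂)
open import Data.Empty using (⊥-elim)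
open import Data.Unit using (tt)
open import Relation.Nullary using (¬_; yes; no; does)
open import Relation.Nullary.Decidable using (T?)
open import Relation.Binary.PropositionalEquality as PE using (_≡_; _≢_; refl)
open import Relation.Binary.Definitions using (DecidableEquality)
open import Data.List.Relation.Binary.Permutation.Propositional
  using (_↭_; prep; swap; ↭-refl; ↭-sym; ↭-trans; ↭-reflexive)
open import Data.List.Relation.Binary.Permutation.Propositional.Properties
  using (++⁺ˡ; ++⁺ʳ; ++⁺; shift; shifts; ++-comm; ↭-length; ↭-empty-inv; ↭-singleton-inv; ∈-resp-↭; drop-∷)
open import Data.List.Relation.Unary.All as All using (All; []; _∷_)
import Data.List.Relation.Unary.All.Properties as AllP
open import Data.List.Relation.Unary.AllPairs as AllPairs using (AllPairs; []; _∷_)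
import Data.List.Relation.Unary.AllPairs.Properties as AllPairsP
open import Data.List.Relation.Unary.Unique.Propositional using (Unique)
open import Data.List.Relation.Unary.Unique.Propositional.Properties using (allFin⁺)
open import Data.List.Membership.Propositional using (_∈_)
open import Data.List.Relation.Unary.Any using (here; there)

false≢true : false ≢ true
false≢true ()

private variable
  a b c r : Level
  A : Set a
  B : Set b
  C : Set c

concatMap-++-↭ : ∀ (f g : A → List B) xs →
                 concatMap (λ x → f x ++ g x) xs ↭ concatMap f xs ++ concatMap g xs
concatMap-++-↭ f g [] = ↭-refl
concatMap-++-↭ f g (x ∷ xs) =
  ↭-trans (↭-reflexive (ListP.++-assoc (f x) (g x) _))
  (↭-trans (++⁺ˡ (f x) (++⁺ˡ (g x) (concatMap-++-↭ f g xs)))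
  (↭-trans (++⁺ˡ (f x) (shifts (g x) (concatMap f xs)))
  (↭-reflexive (PE.sym (ListP.++-assoc (f x) (concatMap f xs) _)))))

concatMap-comm-↭ : ∀ (h : A → B → List C) xs ys →
  concatMap (λ x → concatMap (h x) ys) xs ↭ concatMap (λ y → concatMap (λ x → h x y) xs) ys
concatMap-comm-↭ h [] ys = ↭-reflexive (PE.sym (nil ys))
  where
  nil : ∀ ys → concatMap (λ y → concatMap (λ x → h x y) []) ys ≡ []
  nil [] = refl
  nil (_ ∷ ys) = nil ys
concatMap-comm-↭ h (x ∷ xs) ys =
  ↭-trans (++⁺ˡ (concatMap (h x) ys) (concatMap-comm-↭ h xs ys))
    (↭-sym (concatMap-++-↭ (h x) (λ y → concatMap (λ x′ → h x′ y) xs) ys))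

AllPairs-concatMap-map : ∀ {R : C → C → Set r} (h : A → B → C) {xs ys} → Unique xs → Unique ys →
  (∀ x y x′ y′ → x ≢ x′ ⊎ y ≢ y′ → R (h x y) (h x′ y′)) →
  AllPairs R (concatMap (λ x → map (h x) ys) xs)
AllPairs-concatMap-map h {[]} _ _ _ = []
AllPairs-concatMap-map h {x ∷ xs} {ys} (x∉xs ∷ xs!) ys! R-h =
  AllPairsP.++⁺ (AllPairsP.map⁺ (AllPairs.map (λ ne → R-h x _ x _ (inj₂ ne)) ys!))
                (AllPairs-concatMap-map h xs! ys! R-h)
                (AllP.map⁺ (All.universal (λ y → AllP.concat⁺ (AllP.map⁺
                  (All.map (λ ne → AllP.map⁺ (All.universal (λ y′ → R-h x y _ y′ (inj₁ ne)) ys)) x∉xs))) ys))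

module PolynomialFacts {c ℓ} (F : Field c ℓ) {X : Set} (_≟X_ : DecidableEquality X) where
  open Poly F _≟X_ public
  open Field F renaming (refl to ≈-refl; sym to ≈-sym; trans to ≈-trans)
  open import Relation.Binary.Reasoning.Setoid setoid
  open import Algebra.Properties.Ring ring using (-1*x≈-x)

  removeOne-head : ∀ x ys → removeOne x (x ∷ ys) ≡ just ys
  removeOne-head x ys with x ≟X x
  ... | yes _ = refl
  ... | no x≢x = ⊥-elim (x≢x refl)

  removeOne-sound : ∀ x ys {ys′} → removeOne x ys ≡ just ys′ → ys ↭ x ∷ ys′
  removeOne-sound x (y ∷ ys) eq with x ≟X y
  ... | yes refl with eq
  ...   | refl = ↭-refl
  removeOne-sound x (y ∷ ys) eq | no _ with removeOne x ys in e
  ...   | just zs with eq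
  ...     | refl = ↭-trans (prep y (removeOne-sound x ys e)) (swap y x ↭-refl)
  removeOne-sound x (y ∷ ys) () | no _ | nothing

  removeOne-complete : ∀ x ys → x ∈ ys → ∃ λ ys′ → removeOne x ys ≡ just ys′
  removeOne-complete x (y ∷ ys) x∈ with x ≟X y
  ... | yes _ = ys , refl
  ... | no x≢y with x∈
  ...   | here x≡y = ⊥-elim (x≢y x≡y)
  ...   | there x∈ys with removeOne x ys | removeOne-complete x ys x∈ys
  ...     | just zs | _ = y ∷ zs , refl
  ...     | nothing | (_ , ())

  removeOne-length : ∀ x m {m′} → removeOne x m ≡ just m′ → length m ≡ suc (length m′)
  removeOne-length x m e = ↭-length (removeOne-sound x m e)

  sameBag-sound : ∀ xs ys → sameBag xs ys ≡ true → xs ↭ ys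
  sameBag-sound [] [] _ = ↭-refl
  sameBag-sound (x ∷ xs) ys eq with removeOne x ys in e
  ... | just ys′ = ↭-trans (prep x (sameBag-sound xs ys′ eq)) (↭-sym (removeOne-sound x ys e))

  sameBag-complete : ∀ xs ys → xs ↭ ys → sameBag xs ys ≡ true
  sameBag-complete [] ys p with ↭-empty-inv (↭-sym p)
  ... | refl = refl
  sameBag-complete (x ∷ xs) ys p with removeOne x ys in e | removeOne-complete x ys (∈-resp-↭ p (here refl))
  ... | just ys′ | _ = sameBag-complete xs ys′ (drop-∷ (↭-trans p (removeOne-sound x ys e)))
  ... | nothing | (_ , ())

  sameBag-refl : ∀ m → sameBag m m ≡ true
  sameBag-refl m = sameBag-complete m m ↭-refl

  sameBag-false : ∀ xs ys → ¬ (xs ↭ ys) → sameBag xs ys ≡ false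
  sameBag-false xs ys xs≁ys with sameBag xs ys in e
  ... | true = ⊥-elim (xs≁ys (sameBag-sound xs ys e))
  ... | false = refl

  sameBag-respˡ : ∀ {m₁ m₂} n → m₁ ↭ m₂ → sameBag m₁ n ≡ sameBag m₂ n
  sameBag-respˡ {m₁} {m₂} n p with sameBag m₂ n in e
  ... | true = sameBag-complete m₁ n (↭-trans p (sameBag-sound m₂ n e))
  ... | false = sameBag-false m₁ n (λ q → false≢true (PE.trans (PE.sym e) (sameBag-complete m₂ n (↭-trans (↭-sym p) q))))

  sameBag-length : ∀ m n → sameBag m n ≡ true → length m ≡ length n
  sameBag-length m n e = ↭-length (sameBag-sound m n e)

  sameBag-∷-just : ∀ x n m {m′} → removeOne x m ≡ just m′ → sameBag (x ∷ n) m ≡ sameBag n m′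
  sameBag-∷-just x n m e with removeOne x m
  sameBag-∷-just x n m refl | just _ = refl

  sameBag-∷-nothing : ∀ x n m → removeOne x m ≡ nothing → sameBag (x ∷ n) m ≡ false
  sameBag-∷-nothing x n m e with removeOne x m
  sameBag-∷-nothing x n m refl | nothing = refl

  onlyIf : Bool → Carrier → Carrier
  onlyIf b a = if b then a else 0#

  onlyIf-0 : ∀ b → onlyIf b 0# ≈ 0#
  onlyIf-0 true = ≈-refl
  onlyIf-0 false = ≈-refl

  onlyIf-* : ∀ b a x → onlyIf b (a * x) ≈ a * onlyIf b x
  onlyIf-* true a x = ≈-refl
  onlyIf-* false a x = ≈-sym (zeroʳ a)

  onlyIf-+ : ∀ b x y → onlyIf b (x + y) ≈ onlyIf b x + onlyIf b y
  onlyIf-+ true x y = ≈-refl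
  onlyIf-+ false x y = ≈-sym (+-identityˡ 0#)

  onlyIf-cong : ∀ b {x y} → x ≈ y → onlyIf b x ≈ onlyIf b y
  onlyIf-cong true e = e
  onlyIf-cong false e = ≈-refl

  onlyIf-1 : ∀ b a → onlyIf b a ≈ a * onlyIf b 1#
  onlyIf-1 true a = ≈-sym (*-identityʳ a)
  onlyIf-1 false a = ≈-sym (zeroʳ a)

  scaleTerm : Carrier → Carrier × Mono → Carrier × Mono
  scaleTerm a t = (a * proj₁ t , proj₂ t)

  scale : Carrier → Pol → Pol
  scale a p = map (scaleTerm a) p

  coeff-++ : ∀ p q m → coeff (p ++ q) m ≈ coeff p m + coeff q m
  coeff-++ [] q m = ≈-sym (+-identityˡ _)
  coeff-++ ((a , m′) ∷ p) q m = ≈-trans (+-cong ≈-refl (coeff-++ p q m)) (≈-sym (+-assoc _ _ _))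

  coeff-scale : ∀ a p m → coeff (scale a p) m ≈ a * coeff p m
  coeff-scale a [] m = ≈-sym (zeroʳ a)
  coeff-scale a ((b , m′) ∷ p) m =
    ≈-trans (+-cong (onlyIf-* (sameBag m′ m) a b) (coeff-scale a p m)) (≈-sym (distribˡ a _ _))

  coeff-linComb : ∀ a p b q m → coeff (linComb a p b q) m ≈ a * coeff p m + b * coeff q m
  coeff-linComb a p b q m =
    ≈-trans (coeff-++ (scale a p) (scale b q) m) (+-cong (coeff-scale a p m) (coeff-scale b q m))

  coeff-↭ : ∀ {p q} m → p ↭ q → coeff p m ≈ coeff q m
  coeff-↭ m _↭_.refl = ≈-refl
  coeff-↭ m (prep x pq) = +-cong ≈-refl (coeff-↭ m pq)
  coeff-↭ m (swap x y pq) = begin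
    _ + (_ + _) ≈⟨ ≈-sym (+-assoc _ _ _) ⟩
    (_ + _) + _ ≈⟨ +-cong (+-comm _ _) (coeff-↭ m pq) ⟩
    (_ + _) + _ ≈⟨ +-assoc _ _ _ ⟩
    _ ∎
  coeff-↭ m (_↭_.trans p q) = ≈-trans (coeff-↭ m p) (coeff-↭ m q)

  infix 4 _≈P_ _≋_
  record _≈P_ (p q : Pol) : Set ℓ where
    constructor mk≈
    field get : p ≈ₚ q
  open _≈P_ public

  ≈P-refl : ∀ {p} → p ≈P p
  ≈P-refl = mk≈ λ m → ≈-refl

  ≈P-sym : ∀ {p q} → p ≈P q → q ≈P p
  ≈P-sym e = mk≈ λ m → ≈-sym (get e m)

  ≈P-trans : ∀ {p q r} → p ≈P q → q ≈P r → p ≈P r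
  ≈P-trans e f = mk≈ λ m → ≈-trans (get e m) (get f m)

  ≡⇒≈P : ∀ {p q} → p ≡ q → p ≈P q
  ≡⇒≈P refl = ≈P-refl

  ↭⇒≈P : ∀ {p q} → p ↭ q → p ≈P q
  ↭⇒≈P pq = mk≈ λ m → coeff-↭ m pq

  ≈P-++ : ∀ {p q p′ q′} → p ≈P p′ → q ≈P q′ → (p ++ q) ≈P (p′ ++ q′)
  ≈P-++ {p} {q} {p′} {q′} e f =
    mk≈ λ m → ≈-trans (coeff-++ p q m) (≈-trans (+-cong (get e m) (get f m)) (≈-sym (coeff-++ p′ q′ m)))

  ≈P-scale : ∀ a {p q} → p ≈P q → scale a p ≈P scale a q
  ≈P-scale a {p} {q} e =
    mk≈ λ m → ≈-trans (coeff-scale a p m) (≈-trans (*-cong ≈-refl (get e m)) (≈-sym (coeff-scale a q m)))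

  ≈P-linComb : ∀ a b {p q p′ q′} → p ≈P p′ → q ≈P q′ → linComb a p b q ≈P linComb a p′ b q′
  ≈P-linComb a b e f = ≈P-++ (≈P-scale a e) (≈P-scale b f)

  ≈P-concatMap : ∀ {a} {A : Set a} {f g : A → Pol} xs → (∀ x → f x ≈P g x) → concatMap f xs ≈P concatMap g xs
  ≈P-concatMap [] f≈g = ≈P-refl
  ≈P-concatMap (x ∷ xs) f≈g = ≈P-++ (f≈g x) (≈P-concatMap xs f≈g)

  neg-++-cancel : ∀ p → scale (- 1#) p ++ p ≈P []
  neg-++-cancel p = mk≈ λ n → ≈-trans (coeff-++ (scale (- 1#) p) p n)
    (≈-trans (+-cong (≈-trans (coeff-scale (- 1#) p n) (-1*x≈-x _)) ≈-refl) (-‿inverseˡ _))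

  data _≋_ : Pol → Pol → Set (c ⊔ ℓ) where
    []  : [] ≋ []
    _∷_ : ∀ {a b m m′ p q} → (a ≈ b × m ↭ m′) → p ≋ q → ((a , m) ∷ p) ≋ ((b , m′) ∷ q)

  ≋⇒≈P : ∀ {p q} → p ≋ q → p ≈P q
  ≋⇒≈P e = mk≈ (go e)
    where
    go : ∀ {p q} → p ≋ q → p ≈ₚ q
    go [] n = ≈-refl
    go (_∷_ {m = m} {m′} (a≈b , m↭m′) r) n
      rewrite sameBag-respˡ n m↭m′ = +-cong (onlyIf-cong (sameBag m′ n) a≈b) (go r n)

  ≋-refl : ∀ p → p ≋ p
  ≋-refl [] = []
  ≋-refl (t ∷ p) = (≈-refl , ↭-refl) ∷ ≋-refl p

  ≋-sym : ∀ {p q} → p ≋ q → q ≋ p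
  ≋-sym [] = []
  ≋-sym ((e , m) ∷ l) = (≈-sym e , ↭-sym m) ∷ ≋-sym l

  ≋-trans : ∀ {p q r} → p ≋ q → q ≋ r → p ≋ r
  ≋-trans [] [] = []
  ≋-trans ((e , m) ∷ l) ((e′ , m′) ∷ l′) = (≈-trans e e′ , ↭-trans m m′) ∷ ≋-trans l l′

  ≡⇒≋ : ∀ {p q} → p ≡ q → p ≋ q
  ≡⇒≋ {p} refl = ≋-refl p

  ≋-++ : ∀ {p q p′ q′} → p ≋ p′ → q ≋ q′ → (p ++ q) ≋ (p′ ++ q′)
  ≋-++ [] r = r
  ≋-++ (x ∷ l) r = x ∷ ≋-++ l r

  _≈ₜ_ : Carrier × Mono → Carrier × Mono → Set ℓ
  s ≈ₜ t = proj₁ s ≈ proj₁ t × proj₂ s ↭ proj₂ t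

  ≋-map : ∀ {a} {A : Set a} (f g : A → Carrier × Mono) xs → (∀ x → f x ≈ₜ g x) → map f xs ≋ map g xs
  ≋-map f g [] f≈g = []
  ≋-map f g (x ∷ xs) f≈g = f≈g x ∷ ≋-map f g xs f≈g

  ≋-concatMap : ∀ {a} {A : Set a} (f g : A → Pol) xs → (∀ x → f x ≋ g x) → concatMap f xs ≋ concatMap g xs
  ≋-concatMap f g [] f≋g = []
  ≋-concatMap f g (x ∷ xs) f≋g = ≋-++ (f≋g x) (≋-concatMap f g xs f≋g)

  scale-scale : ∀ a b p → scale a (scale b p) ≋ scale (a * b) p
  scale-scale a b [] = []
  scale-scale a b (t ∷ p) = (≈-sym (*-assoc a b _) , ↭-refl) ∷ scale-scale a b p

  scale-1 : ∀ p → scale 1# p ≋ p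
  scale-1 [] = []
  scale-1 (t ∷ p) = (*-identityˡ _ , ↭-refl) ∷ scale-1 p

  coeff-mulVar-just : ∀ x p m {m′} → removeOne x m ≡ just m′ → coeff (mulVar x p) m ≈ coeff p m′
  coeff-mulVar-just x [] m e = ≈-refl
  coeff-mulVar-just x ((a , n) ∷ p) m e
    rewrite sameBag-∷-just x n m e = +-cong ≈-refl (coeff-mulVar-just x p m e)

  coeff-mulVar-nothing : ∀ x p m → removeOne x m ≡ nothing → coeff (mulVar x p) m ≈ 0#
  coeff-mulVar-nothing x [] m e = ≈-refl
  coeff-mulVar-nothing x ((a , n) ∷ p) m e
    rewrite sameBag-∷-nothing x n m e = ≈-trans (+-identityˡ _) (coeff-mulVar-nothing x p m e)

  ≈P-mulVar : ∀ x {p q} → p ≈P q → mulVar x p ≈P mulVar x q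
  ≈P-mulVar x {p} {q} e = mk≈ f
    where
    f : ∀ m → coeff (mulVar x p) m ≈ coeff (mulVar x q) m
    f m with removeOne x m in r
    ... | just m′ = ≈-trans (coeff-mulVar-just x p m r) (≈-trans (get e m′) (≈-sym (coeff-mulVar-just x q m r)))
    ... | nothing = ≈-trans (coeff-mulVar-nothing x p m r) (≈-sym (coeff-mulVar-nothing x q m r))

  record DegLt (E : ℕ) (p : Pol) : Set ℓ where
    constructor mkD
    field getD : ∀ m → E ≤ length m → coeff p m ≈ 0#
  open DegLt public

  DegLt-resp : ∀ {E p q} → p ≈P q → DegLt E p → DegLt E q
  DegLt-resp e d = mkD λ m l → ≈-trans (≈-sym (get e m)) (getD d m l)

  DegLt-mono : ∀ {E E′ p} → E ≤ E′ → DegLt E p → DegLt E′ p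
  DegLt-mono le d = mkD λ m l → getD d m (ℕP.≤-trans le l)

  DegLt-++ : ∀ {E} p q → DegLt E p → DegLt E q → DegLt E (p ++ q)
  DegLt-++ p q dp dq =
    mkD λ m l → ≈-trans (coeff-++ p q m) (≈-trans (+-cong (getD dp m l) (getD dq m l)) (+-identityˡ 0#))

  DegLt-scale : ∀ {E} a p → DegLt E p → DegLt E (scale a p)
  DegLt-scale a p d = mkD λ m l → ≈-trans (coeff-scale a p m) (≈-trans (*-cong ≈-refl (getD d m l)) (zeroʳ a))

  DegLt-linComb : ∀ {E} a p b q → DegLt E p → DegLt E q → DegLt E (linComb a p b q)
  DegLt-linComb a p b q dp dq = DegLt-++ (scale a p) (scale b q) (DegLt-scale a p dp) (DegLt-scale b q dq)

  DegLt-mulVar : ∀ {E} x p → DegLt E p → DegLt (suc E) (mulVar x p)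
  DegLt-mulVar x p d = mkD f
    where
    f : ∀ m → _ ≤ length m → coeff (mulVar x p) m ≈ 0#
    f m l with removeOne x m in r
    ... | just m′ = ≈-trans (coeff-mulVar-just x p m r)
          (getD d m′ (ℕP.≤-pred (PE.subst (suc _ ≤_) (removeOne-length x m r) l)))
    ... | nothing = coeff-mulVar-nothing x p m r

  DegLt-mulVar⁻ : ∀ {E} x p → DegLt (suc E) (mulVar x p) → DegLt E p
  DegLt-mulVar⁻ x p d = mkD λ m l →
    ≈-trans (≈-sym (coeff-mulVar-just x p (x ∷ m) (removeOne-head x m))) (getD d (x ∷ m) (s≤s l))

  Short : ℕ → Pol → Set c
  Short E p = All (λ t → length (proj₂ t) < E) p

  Short-mono : ∀ {E E′ p} → E ≤ E′ → Short E p → Short E′ p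
  Short-mono le = All.map (λ s → ℕP.<-≤-trans s le)

  Short-scale : ∀ {E} a p → Short E p → Short E (scale a p)
  Short-scale a p s = AllP.map⁺ s

  Short⇒DegLt : ∀ {E p} → Short E p → DegLt E p
  Short⇒DegLt s = mkD (go s)
    where
    go : ∀ {E p} → Short E p → ∀ m → E ≤ length m → coeff p m ≈ 0#
    go [] m l = ≈-refl
    go (_∷_ {x = (a , n)} s ss) m l with sameBag n m in e
    ... | true = ⊥-elim (ℕP.<-irrefl (sameBag-length n m e) (ℕP.<-≤-trans s l))
    ... | false = ≈-trans (+-identityˡ _) (go ss m l)

  DegLe-booleanAxiom : ∀ {d} x → DegLe d (booleanAxiom x) → 2 ≤ d
  DegLe-booleanAxiom {d} x dg with 2 ℕ.≤? d
  ... | yes le = le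
  ... | no gt = ⊥-elim (1≉0 (≈-trans (≈-sym coeff-xx) (dg (x ∷ x ∷ []) (ℕP.≰⇒> gt))))
    where
    coeff-xx : coeff (booleanAxiom x) (x ∷ x ∷ []) ≈ 1#
    coeff-xx rewrite sameBag-refl (x ∷ x ∷ []) | sameBag-∷-just x [] (x ∷ x ∷ []) (removeOne-head x (x ∷ []))
      = ≈-trans (+-cong ≈-refl (+-identityˡ _)) (+-identityʳ _)

  truncate : ℕ → Pol → Pol
  truncate E p = filterᵇ (λ t → length (proj₂ t) ℕ.<ᵇ E) p

  Short-truncate : ∀ E p → Short E (truncate E p)
  Short-truncate E [] = []
  Short-truncate E ((a , n) ∷ p) with length n ℕ.<ᵇ E in e
  ... | true = ℕP.<ᵇ⇒< (length n) E (PE.subst T (PE.sym e) tt) ∷ Short-truncate E p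
  ... | false = Short-truncate E p

  truncate-≈P : ∀ E p → DegLt E p → truncate E p ≈P p
  truncate-≈P E p d = mk≈ f
    where
    low : ∀ p m → length m < E → coeff (truncate E p) m ≈ coeff p m
    low [] m l = ≈-refl
    low ((a , n) ∷ p) m l with length n ℕ.<ᵇ E in e
    ... | true = +-cong ≈-refl (low p m l)
    ... | false with sameBag n m in e₂
    ...   | true = ⊥-elim (PE.subst T e (PE.subst (λ z → T (z ℕ.<ᵇ E)) (PE.sym (sameBag-length n m e₂)) (ℕP.<⇒<ᵇ l)))
    ...   | false = ≈-trans (low p m l) (≈-sym (+-identityˡ _))
    f : ∀ m → coeff (truncate E p) m ≈ coeff p m
    f m with ℕP.<-≤-connex (length m) E
    ... | inj₁ l = low p m l
    ... | inj₂ l = ≈-trans (getD (Short⇒DegLt (Short-truncate E p)) m l) (≈-sym (getD d m l))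

  DegLe-∷ : ∀ {d} a m p → ¬ (a ≈ 0#) → All (λ t → sameBag (proj₂ t) m ≡ false) p → DegLe d ((a , m) ∷ p) → length m ≤ d
  DegLe-∷ {d} a m p a≉0 others dg with length m ℕ.≤? d
  ... | yes le = le
  ... | no gt = ⊥-elim (a≉0 (≈-trans (≈-sym coeff-m) (dg m (ℕP.≰⇒> gt))))
    where
    coeff-others : ∀ {p} → All (λ t → sameBag (proj₂ t) m ≡ false) p → coeff p m ≈ 0#
    coeff-others [] = ≈-refl
    coeff-others (e ∷ es) rewrite e = ≈-trans (+-identityˡ _) (coeff-others es)
    coeff-m : coeff ((a , m) ∷ p) m ≈ a
    coeff-m rewrite sameBag-refl m = ≈-trans (+-cong ≈-refl (coeff-others others)) (+-identityʳ a)

  evalWith : (Mono → Carrier) → Pol → Carrier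
  evalWith g [] = 0#
  evalWith g ((a , m) ∷ p) = a * g m + evalWith g p

  evalWith-++ : ∀ g p q → evalWith g (p ++ q) ≈ evalWith g p + evalWith g q
  evalWith-++ g [] q = ≈-sym (+-identityˡ _)
  evalWith-++ g ((a , m) ∷ p) q = ≈-trans (+-cong ≈-refl (evalWith-++ g p q)) (≈-sym (+-assoc _ _ _))

  evalWith-scale : ∀ g b p → evalWith g (scale b p) ≈ b * evalWith g p
  evalWith-scale g b [] = ≈-sym (zeroʳ b)
  evalWith-scale g b ((a , m) ∷ p) =
    ≈-trans (+-cong (*-assoc b a (g m)) (evalWith-scale g b p)) (≈-sym (distribˡ b _ _))

  evalWith-0 : ∀ p → evalWith (λ _ → 0#) p ≈ 0#
  evalWith-0 [] = ≈-refl
  evalWith-0 ((a , m) ∷ p) = ≈-trans (+-cong (zeroʳ a) (evalWith-0 p)) (+-identityˡ 0#)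

  evalWith-const : ∀ x p → evalWith (λ _ → x) p ≈ evalWith (λ _ → 1#) p * x
  evalWith-const x [] = ≈-sym (zeroˡ x)
  evalWith-const x ((a , m) ∷ p) = begin
    a * x + evalWith (λ _ → x) p               ≈⟨ +-cong (*-cong (≈-sym (*-identityʳ a)) ≈-refl) (evalWith-const x p) ⟩
    (a * 1#) * x + evalWith (λ _ → 1#) p * x   ≈⟨ ≈-sym (distribʳ x _ _) ⟩
    (a * 1# + evalWith (λ _ → 1#) p) * x       ∎

  evalWith-filter : ∀ (P : Carrier × Mono → Bool) g p →
    evalWith g p ≈ evalWith g (filterᵇ P p) + evalWith g (filterᵇ (not ∘ P) p)
  evalWith-filter P g [] = ≈-sym (+-identityˡ 0#)
  evalWith-filter P g ((a , m) ∷ p) with P (a , m)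
  ... | true = ≈-trans (+-cong ≈-refl (evalWith-filter P g p)) (≈-sym (+-assoc _ _ _))
  ... | false = begin
      a * g m + evalWith g p                                   ≈⟨ +-cong ≈-refl (evalWith-filter P g p) ⟩
      a * g m + (evalWith g (filterᵇ P p) + _)                 ≈⟨ ≈-sym (+-assoc _ _ _) ⟩
      (a * g m + evalWith g (filterᵇ P p)) + _                 ≈⟨ +-cong (+-comm _ _) ≈-refl ⟩
      (evalWith g (filterᵇ P p) + a * g m) + _                 ≈⟨ +-assoc _ _ _ ⟩
      evalWith g (filterᵇ P p) + (a * g m + _)                 ∎

  evalWith-cong-on : ∀ (P : Mono → Bool) g h p → (∀ n → P n ≡ true → g n ≈ h n) →
    evalWith g (filterᵇ (P ∘ proj₂) p) ≈ evalWith h (filterᵇ (P ∘ proj₂) p)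
  evalWith-cong-on P g h [] g≈h = ≈-refl
  evalWith-cong-on P g h ((a , m) ∷ p) g≈h with P m in e
  ... | true = +-cong (*-cong ≈-refl (g≈h m e)) (evalWith-cong-on P g h p g≈h)
  ... | false = evalWith-cong-on P g h p g≈h

  indicator : Mono → Mono → Carrier
  indicator n m = onlyIf (sameBag m n) 1#

  coeff-evalWith : ∀ p n → coeff p n ≈ evalWith (indicator n) p
  coeff-evalWith [] n = ≈-refl
  coeff-evalWith ((a , m) ∷ p) n = +-cong (onlyIf-1 (sameBag m n) a) (coeff-evalWith p n)

  RespectsBag : (Mono → Carrier) → Set ℓ
  RespectsBag g = ∀ m m′ → sameBag m m′ ≡ true → g m ≈ g m′

  like unlike : Mono → Pol → Pol
  like m = filterᵇ (λ t → sameBag (proj₂ t) m)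
  unlike m = filterᵇ (λ t → not (sameBag (proj₂ t) m))

  evalWith-like-unlike : ∀ g → RespectsBag g → ∀ m p →
    evalWith g p ≈ evalWith (λ _ → 1#) (like m p) * g m + evalWith g (unlike m p)
  evalWith-like-unlike g g-bag m p = begin
    evalWith g p                                             ≈⟨ evalWith-filter (λ t → sameBag (proj₂ t) m) g p ⟩
    evalWith g (like m p) + evalWith g (unlike m p)          ≈⟨ +-cong (evalWith-cong-on (λ n → sameBag n m) g (λ _ → g m) p
                                                                  (λ n → g-bag n m)) ≈-refl ⟩
    evalWith (λ _ → g m) (like m p) + evalWith g (unlike m p) ≈⟨ +-cong (evalWith-const (g m) (like m p)) ≈-refl ⟩
    evalWith (λ _ → 1#) (like m p) * g m + evalWith g (unlike m p) ∎

  indicator-respectsBag : ∀ n → RespectsBag (indicator n)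
  indicator-respectsBag n m m′ e rewrite sameBag-respˡ n (sameBag-sound m m′ e) = ≈-refl

  indicator-off : ∀ {n} (P : Mono → Bool) → (∀ n′ → P n′ ≡ true → sameBag n′ n ≡ false) →
    ∀ p → evalWith (indicator n) (filterᵇ (P ∘ proj₂) p) ≈ 0#
  indicator-off {n = n} P off p = ≈-trans (evalWith-cong-on P (indicator n) (λ _ → 0#) p h) (evalWith-0 (filterᵇ (P ∘ proj₂) p))
    where
    h : ∀ n′ → P n′ ≡ true → indicator n n′ ≈ 0#
    h n′ e rewrite off n′ e = ≈-refl

  sameBag-trans : ∀ m n o → sameBag m n ≡ true → sameBag n o ≡ true → sameBag m o ≡ true
  sameBag-trans m n o e e′ = sameBag-complete m o (↭-trans (sameBag-sound m n e) (sameBag-sound n o e′))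

  sameBag-sym : ∀ m n → sameBag m n ≡ true → sameBag n m ≡ true
  sameBag-sym m n e = sameBag-complete n m (↭-sym (sameBag-sound m n e))

  indicator-self : ∀ m → indicator m m ≈ 1#
  indicator-self m rewrite sameBag-refl m = ≈-refl

  not-true : ∀ {b} → not b ≡ true → b ≡ false
  not-true {false} _ = refl

  coeff-like : ∀ m p → coeff p m ≈ evalWith (λ _ → 1#) (like m p)
  coeff-like m p = begin
    coeff p m                                                            ≈⟨ coeff-evalWith p m ⟩
    evalWith (indicator m) p                                             ≈⟨ evalWith-like-unlike (indicator m) (indicator-respectsBag m) m p ⟩
    evalWith (λ _ → 1#) (like m p) * indicator m m + evalWith (indicator m) (unlike m p)
        ≈⟨ +-cong (*-cong ≈-refl (indicator-self m)) (indicator-off (λ n → not (sameBag n m)) (λ n′ → not-true) p) ⟩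
    evalWith (λ _ → 1#) (like m p) * 1# + 0#                             ≈⟨ +-identityʳ _ ⟩
    evalWith (λ _ → 1#) (like m p) * 1#                                  ≈⟨ *-identityʳ _ ⟩
    evalWith (λ _ → 1#) (like m p)                                       ∎

  coeff-unlike-like : ∀ {m n} p → sameBag m n ≡ true → coeff (unlike m p) n ≈ 0#
  coeff-unlike-like {m} {n} p m∼n = ≈-trans (coeff-evalWith (unlike m p) n)
    (indicator-off (λ n′ → not (sameBag n′ m)) off p)
    where
    off : ∀ n′ → not (sameBag n′ m) ≡ true → sameBag n′ n ≡ false
    off n′ n′≁m with sameBag n′ n in n′∼n
    ... | true = ⊥-elim (false≢true (PE.trans (PE.sym (not-true n′≁m)) (sameBag-trans n′ n m n′∼n (sameBag-sym m n m∼n))))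
    ... | false = refl

  coeff-unlike-unlike : ∀ {m n} p → sameBag m n ≡ false → coeff (unlike m p) n ≈ coeff p n
  coeff-unlike-unlike {m} {n} p m≁n = begin
    coeff (unlike m p) n                                              ≈⟨ coeff-evalWith (unlike m p) n ⟩
    evalWith (indicator n) (unlike m p)                               ≈⟨ ≈-sym (+-identityˡ _) ⟩
    0# + evalWith (indicator n) (unlike m p)                          ≈⟨ +-cong (≈-sym (indicator-off (λ n′ → sameBag n′ m) off p)) ≈-refl ⟩
    evalWith (indicator n) (like m p) + evalWith (indicator n) (unlike m p) ≈⟨ ≈-sym (evalWith-filter (λ t → sameBag (proj₂ t) m) (indicator n) p) ⟩
    evalWith (indicator n) p                                          ≈⟨ ≈-sym (coeff-evalWith p n) ⟩
    coeff p n                                                         ∎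
    where
    off : ∀ n′ → sameBag n′ m ≡ true → sameBag n′ n ≡ false
    off n′ n′∼m with sameBag n′ n in n′∼n
    ... | true = ⊥-elim (false≢true (PE.trans (PE.sym m≁n) (sameBag-trans m n′ n (sameBag-sym n′ m n′∼m) n′∼n)))
    ... | false = refl

  unlike-≈P-[] : ∀ m {p} → p ≈P [] → unlike m p ≈P []
  unlike-≈P-[] m {p} p≈0 = mk≈ f
    where
    f : ∀ n → coeff (unlike m p) n ≈ 0#
    f n with sameBag m n in e
    ... | true = coeff-unlike-like p e
    ... | false = ≈-trans (coeff-unlike-unlike p e) (get p≈0 n)

  length-unlike-∷ : ∀ a m r → length (unlike m ((a , m) ∷ r)) ≤ length r
  length-unlike-∷ a m r rewrite sameBag-refl m = ListP.length-filter (T? ∘ (λ t → not (sameBag (proj₂ t) m))) r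

  -- Polynomials are lists, so this is not automatic: remove all terms with the head's monomial,
  -- whose coefficients sum to 0, and recurse on the shorter rest.
  evalWith-≈P-[] : ∀ g → RespectsBag g → ∀ fuel p → length p ≤ fuel → p ≈P [] → evalWith g p ≈ 0#
  evalWith-≈P-[] g g-bag _ [] _ _ = ≈-refl
  evalWith-≈P-[] g g-bag (suc fuel) p@((a , m) ∷ r) (s≤s l) p≈0 = begin
    evalWith g p                                                 ≈⟨ evalWith-like-unlike g g-bag m p ⟩
    evalWith (λ _ → 1#) (like m p) * g m + evalWith g (unlike m p) ≈⟨ +-cong (*-cong like≈0 ≈-refl) unlike≈0 ⟩
    0# * g m + 0#                                                ≈⟨ +-identityʳ _ ⟩
    0# * g m                                                     ≈⟨ zeroˡ _ ⟩
    0#                                                           ∎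
    where
    like≈0 : evalWith (λ _ → 1#) (like m p) ≈ 0#
    like≈0 = ≈-trans (≈-sym (coeff-like m p)) (get p≈0 m)
    unlike≈0 : evalWith g (unlike m p) ≈ 0#
    unlike≈0 = evalWith-≈P-[] g g-bag fuel (unlike m p) (ℕP.≤-trans (length-unlike-∷ a m r) l) (unlike-≈P-[] m p≈0)

  evalWith-resp : ∀ g → RespectsBag g → ∀ {p q} → p ≈P q → evalWith g p ≈ evalWith g q
  evalWith-resp g g-bag {p} {q} p≈q = begin
      evalWith g p                                  ≈⟨ ≈-sym (+-identityʳ _) ⟩
      evalWith g p + 0#                             ≈⟨ +-cong ≈-refl (≈-sym (-‿inverseˡ (evalWith g q))) ⟩
      evalWith g p + (- evalWith g q + evalWith g q) ≈⟨ ≈-sym (+-assoc _ _ _) ⟩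
      (evalWith g p + - evalWith g q) + evalWith g q ≈⟨ +-cong difference≈0 ≈-refl ⟩
      0# + evalWith g q                             ≈⟨ +-identityˡ _ ⟩
      evalWith g q                                  ∎
    where
    difference = p ++ scale (- 1#) q
    difference≈P[] : difference ≈P []
    difference≈P[] = mk≈ λ m → ≈-trans (coeff-++ p (scale (- 1#) q) m)
      (≈-trans (+-cong (get p≈q m) (≈-trans (coeff-scale (- 1#) q m) (-1*x≈-x _))) (-‿inverseʳ _))
    difference≈0 : evalWith g p + - evalWith g q ≈ 0#
    difference≈0 = ≈-trans (+-cong ≈-refl (≈-sym (-1*x≈-x _)))
      (≈-trans (≈-sym (≈-trans (evalWith-++ g p _) (+-cong ≈-refl (evalWith-scale g (- 1#) q))))
               (evalWith-≈P-[] g g-bag (length difference) difference ℕP.≤-refl difference≈P[]))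

  prepend : Mono → Pol → Pol
  prepend m q = map (λ s → (proj₁ s , m ++ proj₂ s)) q

  prepend-[] : ∀ q → prepend [] q ≡ q
  prepend-[] [] = refl
  prepend-[] (t ∷ q) = PE.cong (t ∷_) (prepend-[] q)

  prepend-∷ : ∀ y m q → prepend (y ∷ m) q ≡ mulVar y (prepend m q)
  prepend-∷ y m [] = refl
  prepend-∷ y m (t ∷ q) = PE.cong (_ ∷_) (prepend-∷ y m q)

  ≈P-prepend : ∀ m {q q′} → q ≈P q′ → prepend m q ≈P prepend m q′
  ≈P-prepend [] {q} {q′} e = ≈P-trans (≡⇒≈P (prepend-[] q)) (≈P-trans e (≡⇒≈P (PE.sym (prepend-[] q′))))
  ≈P-prepend (y ∷ m) {q} {q′} e =
    ≈P-trans (≡⇒≈P (prepend-∷ y m q)) (≈P-trans (≈P-mulVar y (≈P-prepend m e)) (≡⇒≈P (PE.sym (prepend-∷ y m q′))))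

  DegLt-prepend : ∀ {E} m q → DegLt E q → DegLt (length m ℕ.+ E) (prepend m q)
  DegLt-prepend [] q d = DegLt-resp (≡⇒≈P (PE.sym (prepend-[] q))) d
  DegLt-prepend (y ∷ m) q d =
    DegLt-resp (≡⇒≈P (PE.sym (prepend-∷ y m q))) (DegLt-mulVar y (prepend m q) (DegLt-prepend m q d))

  -- Zero is included separately: for small D there may be no derivable line to scale by 0.
  module Derivations {a} (Ax : Pol → Set a) (D : ℕ) where

    Der : Pol → Set (c ⊔ ℓ ⊔ a)
    Der q = (q ≈P []) ⊎ (∃ λ p → Derivable Ax D p × p ≈P q)

    Derivable-DegLt : ∀ {p} → Derivable Ax D p → DegLt (suc D) p
    Derivable-DegLt (boolean x d) = mkD d
    Derivable-DegLt (input _ d) = mkD d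
    Derivable-DegLt (lin _ _ _ _ d) = mkD d
    Derivable-DegLt (mul _ _ d) = mkD d

    Der-resp : ∀ {q q′} → q ≈P q′ → Der q → Der q′
    Der-resp e (inj₁ z) = inj₁ (≈P-trans (≈P-sym e) z)
    Der-resp e (inj₂ (p , d , e′)) = inj₂ (p , d , ≈P-trans e′ e)

    Der-zero : ∀ {q} → q ≈P [] → Der q
    Der-zero = inj₁

    Der-[] : Der []
    Der-[] = Der-zero ≈P-refl

    Der-input : ∀ {p} → Ax p → DegLt (suc D) p → Der p
    Der-input ax d = inj₂ (_ , input ax (getD d) , ≈P-refl)

    Der-booleanAxiom : ∀ x → 2 ≤ D → Der (booleanAxiom x)
    Der-booleanAxiom x le =
      inj₂ (_ , boolean x (getD (DegLt-mono (s≤s le) (Short⇒DegLt (ℕP.≤-refl ∷ s≤s (s≤s z≤n) ∷ [])))) , ≈P-refl)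

    Der-lin : ∀ a b {p q} → Der p → Der q → Der (linComb a p b q)
    Der-lin a b (inj₁ p≈0) (inj₁ q≈0) = inj₁ (≈P-trans (≈P-linComb a b p≈0 q≈0) (mk≈ λ m → ≈-refl))
    Der-lin a b {p} {q} (inj₂ (p′ , dp , e)) (inj₁ q≈0) =
      inj₂ (linComb a p′ 0# p′ , lin a 0# dp dp (getD (DegLt-linComb a p′ 0# p′ dp′ dp′)) , mk≈ f)
      where
      dp′ = Derivable-DegLt dp
      f : ∀ m → coeff (linComb a p′ 0# p′) m ≈ coeff (linComb a p b q) m
      f m = ≈-trans (coeff-linComb a p′ 0# p′ m) (≈-trans (+-cong (*-cong ≈-refl (get e m))
              (≈-trans (zeroˡ _) (≈-sym (≈-trans (*-cong ≈-refl (get q≈0 m)) (zeroʳ b))))) (≈-sym (coeff-linComb a p b q m)))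
    Der-lin a b {p} {q} (inj₁ p≈0) (inj₂ (q′ , dq , e)) =
      inj₂ (linComb 0# q′ b q′ , lin 0# b dq dq (getD (DegLt-linComb 0# q′ b q′ dq′ dq′)) , mk≈ f)
      where
      dq′ = Derivable-DegLt dq
      f : ∀ m → coeff (linComb 0# q′ b q′) m ≈ coeff (linComb a p b q) m
      f m = ≈-trans (coeff-linComb 0# q′ b q′ m) (≈-trans (+-cong
              (≈-trans (zeroˡ _) (≈-sym (≈-trans (*-cong ≈-refl (get p≈0 m)) (zeroʳ a)))) (*-cong ≈-refl (get e m)))
              (≈-sym (coeff-linComb a p b q m)))
    Der-lin a b (inj₂ (p′ , dp , e)) (inj₂ (q′ , dq , e′)) =
      inj₂ (_ , lin a b dp dq (getD (DegLt-linComb a _ b _ (Derivable-DegLt dp) (Derivable-DegLt dq))) , ≈P-linComb a b e e′)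

    Der-mulVar : ∀ x {p} → DegLt D p → Der p → Der (mulVar x p)
    Der-mulVar x d (inj₁ z) = inj₁ (≈P-mulVar x z)
    Der-mulVar x d (inj₂ (p′ , dp , e)) =
      inj₂ (_ , mul x dp (getD (DegLt-mulVar x p′ (DegLt-resp (≈P-sym e) d))) , ≈P-mulVar x e)

    Der-scale : ∀ a {p} → Der p → Der (scale a p)
    Der-scale a {p} dp = Der-resp (mk≈ f) (Der-lin a 0# dp dp)
      where
      f : ∀ m → coeff (linComb a p 0# p) m ≈ coeff (scale a p) m
      f m = ≈-trans (coeff-linComb a p 0# p m)
              (≈-trans (+-cong ≈-refl (zeroˡ _)) (≈-trans (+-identityʳ _) (≈-sym (coeff-scale a p m))))

    Der-++ : ∀ {p q} → Der p → Der q → Der (p ++ q)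
    Der-++ {p} {q} dp dq = Der-resp (mk≈ f) (Der-lin 1# 1# dp dq)
      where
      f : ∀ m → coeff (linComb 1# p 1# q) m ≈ coeff (p ++ q) m
      f m = ≈-trans (coeff-linComb 1# p 1# q m) (≈-trans (+-cong (*-identityˡ _) (*-identityˡ _)) (≈-sym (coeff-++ p q m)))

    Der-concatMap : ∀ {b} {A : Set b} (f : A → Pol) xs → (∀ x → Der (f x)) → Der (concatMap f xs)
    Der-concatMap f [] _ = Der-[]
    Der-concatMap f (x ∷ xs) Der-f = Der-++ (Der-f x) (Der-concatMap f xs Der-f)

    Der-prepend : ∀ m {q} E → length m ℕ.+ E ≤ suc D → DegLt E q → Der q → Der (prepend m q)
    Der-prepend [] {q} E le d dq = Der-resp (≡⇒≈P (PE.sym (prepend-[] q))) dq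
    Der-prepend (y ∷ m) {q} E le d dq =
      Der-resp (≡⇒≈P (PE.sym (prepend-∷ y m q)))
        (Der-mulVar y (DegLt-mono (ℕP.≤-pred le) (DegLt-prepend m q d))
          (Der-prepend m E (ℕP.m≤n⇒m≤1+n (ℕP.≤-pred le)) d dq))

  infixl 7 _·ₜ_
  _·ₜ_ : Carrier × Mono → Carrier × Mono → Carrier × Mono
  s ·ₜ t = (proj₁ s * proj₁ t , proj₂ s ++ proj₂ t)

  infixr 7 _⊗_
  _⊗_ : Pol → Pol → Pol
  p ⊗ q = concatMap (λ t → map (t ·ₜ_) q) p

  map-·ₜ : ∀ t q → map (t ·ₜ_) q ≡ scale (proj₁ t) (prepend (proj₂ t) q)
  map-·ₜ t [] = refl
  map-·ₜ t (u ∷ q) = PE.cong (_ ∷_) (map-·ₜ t q)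

  ⊗-[] : ∀ p → p ⊗ [] ≡ []
  ⊗-[] [] = refl
  ⊗-[] (t ∷ p) = ⊗-[] p

  ⊗-oneP : ∀ q → q ⊗ oneP ≋ q
  ⊗-oneP [] = []
  ⊗-oneP (t ∷ q) = (*-identityʳ _ , ↭-reflexive (ListP.++-identityʳ (proj₂ t))) ∷ ⊗-oneP q

  ≈P-⊗ʳ : ∀ p {q q′} → q ≈P q′ → p ⊗ q ≈P p ⊗ q′
  ≈P-⊗ʳ [] e = ≈P-refl
  ≈P-⊗ʳ (t ∷ p) {q} {q′} e =
    ≈P-++ (≈P-trans (≡⇒≈P (map-·ₜ t q))
            (≈P-trans (≈P-scale (proj₁ t) (≈P-prepend (proj₂ t) e)) (≡⇒≈P (PE.sym (map-·ₜ t q′)))))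
          (≈P-⊗ʳ p e)

  Short-map-·ₜ : ∀ {A B} t q → length (proj₂ t) < suc A → Short (suc B) q → Short (suc (A ℕ.+ B)) (map (t ·ₜ_) q)
  Short-map-·ₜ {A} {B} t q s sq = AllP.map⁺ (All.map (λ {u} → bound u) sq)
    where
    bound : ∀ u → length (proj₂ u) < suc B → length (proj₂ t ++ proj₂ u) < suc (A ℕ.+ B)
    bound u s′ = PE.subst (_< suc (A ℕ.+ B)) (PE.sym (ListP.length-++ (proj₂ t)))
                     (s≤s (ℕP.+-mono-≤ (ℕP.≤-pred s) (ℕP.≤-pred s′)))

  Short-map-·ₜʳ : ∀ {A B} t q → length (proj₂ t) < suc B → Short (suc A) q → Short (suc (A ℕ.+ B)) (map (_·ₜ t) q)
  Short-map-·ₜʳ {A} {B} t q s sq = AllP.map⁺ (All.map (λ {u} → bound u) sq)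
    where
    bound : ∀ u → length (proj₂ u) < suc A → length (proj₂ u ++ proj₂ t) < suc (A ℕ.+ B)
    bound u s′ = PE.subst (_< suc (A ℕ.+ B)) (PE.sym (ListP.length-++ (proj₂ u)))
                   (s≤s (ℕP.+-mono-≤ (ℕP.≤-pred s′) (ℕP.≤-pred s)))

  Short-⊗ : ∀ {A B p q} → Short (suc A) p → Short (suc B) q → Short (suc (A ℕ.+ B)) (p ⊗ q)
  Short-⊗ [] sq = []
  Short-⊗ {p = t ∷ p} {q} (s ∷ sp) sq = AllP.++⁺ (Short-map-·ₜ t q s sq) (Short-⊗ sp sq)

  private
    ⊗-⊗-nested : ∀ p q r → p ⊗ (q ⊗ r) ≡ concatMap (λ t → concatMap (λ s → map (λ u → t ·ₜ (s ·ₜ u)) r) q) p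
    ⊗-⊗-nested p q r = ListP.concatMap-cong (λ t → PE.trans (ListP.map-concatMap (t ·ₜ_) (λ s → map (s ·ₜ_) r) q)
                         (ListP.concatMap-cong (λ s → PE.sym (ListP.map-∘ r)) q)) p

  *-left-comm : ∀ a b x → a * (b * x) ≈ b * (a * x)
  *-left-comm a b x = ≈-trans (≈-sym (*-assoc a b x)) (≈-trans (*-cong (*-comm a b) ≈-refl) (*-assoc b a x))

  ⊗-left-comm : ∀ p q r → p ⊗ (q ⊗ r) ≈P q ⊗ (p ⊗ r)
  ⊗-left-comm p q r =
    ≈P-trans (≡⇒≈P (⊗-⊗-nested p q r))
    (≈P-trans (↭⇒≈P (concatMap-comm-↭ (λ t s → map (λ u → t ·ₜ (s ·ₜ u)) r) p q))
    (≈P-trans (≋⇒≈P (≋-concatMap _ _ q λ s → ≋-concatMap _ _ p λ t → ≋-map _ _ r λ u →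
                 *-left-comm _ _ _ , shifts (proj₂ t) (proj₂ s)))
    (≡⇒≈P (PE.sym (⊗-⊗-nested q p r)))))

module Substitution {c ℓ} (F : Field c ℓ) {X Y : Set} (_≟X_ : DecidableEquality X) (_≟Y_ : DecidableEquality Y)
                    (ρ : X → Poly.Pol F _≟Y_) where
  module PX = PolynomialFacts F _≟X_
  open PolynomialFacts F _≟Y_
  open Field F renaming (refl to ≈-refl; sym to ≈-sym; trans to ≈-trans)

  σᵐ : PX.Mono → Pol
  σᵐ [] = oneP
  σᵐ (x ∷ m) = ρ x ⊗ σᵐ m

  σ : PX.Pol → Pol
  σ p = concatMap (λ t → scale (proj₁ t) (σᵐ (proj₂ t))) p

  σᵐ-↭ : ∀ {m m′} → m ↭ m′ → σᵐ m ≈P σᵐ m′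
  σᵐ-↭ _↭_.refl = ≈P-refl
  σᵐ-↭ (prep x p) = ≈P-⊗ʳ (ρ x) (σᵐ-↭ p)
  σᵐ-↭ (swap {ys = ys} x y p) = ≈P-trans (≈P-⊗ʳ (ρ x) (≈P-⊗ʳ (ρ y) (σᵐ-↭ p))) (⊗-left-comm (ρ x) (ρ y) (σᵐ ys))
  σᵐ-↭ (_↭_.trans p q) = ≈P-trans (σᵐ-↭ p) (σᵐ-↭ q)

  coeff-σ : ∀ p n → coeff (σ p) n ≈ PX.evalWith (λ m → coeff (σᵐ m) n) p
  coeff-σ [] n = ≈-refl
  coeff-σ ((a , m) ∷ p) n = ≈-trans (coeff-++ (scale a (σᵐ m)) (σ p) n) (+-cong (coeff-scale a (σᵐ m) n) (coeff-σ p n))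

  σ-resp : ∀ {p q} → p PX.≈P q → σ p ≈P σ q
  σ-resp {p} {q} e = mk≈ λ n → ≈-trans (coeff-σ p n) (≈-trans
      (PX.evalWith-resp (λ m → coeff (σᵐ m) n) (λ m m′ s → get (σᵐ-↭ (PX.sameBag-sound m m′ s)) n) e)
      (≈-sym (coeff-σ q n)))

  σ-++ : ∀ p q → σ (p ++ q) ≡ σ p ++ σ q
  σ-++ p q = ListP.concatMap-++ _ p q

  σ-scale : ∀ a p → σ (PX.scale a p) ≋ scale a (σ p)
  σ-scale a [] = []
  σ-scale a ((b , m) ∷ p) = PE.subst (σ (PX.scale a ((b , m) ∷ p)) ≋_)
      (PE.sym (ListP.map-++ (scaleTerm a) (scale b (σᵐ m)) (σ p)))
      (≋-++ (≋-sym (scale-scale a b (σᵐ m))) (σ-scale a p))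

  σ-linComb : ∀ a p b q → σ (PX.linComb a p b q) ≈P linComb a (σ p) b (σ q)
  σ-linComb a p b q = ≈P-trans (≡⇒≈P (σ-++ (PX.scale a p) (PX.scale b q))) (≈P-++ (≋⇒≈P (σ-scale a p)) (≋⇒≈P (σ-scale b q)))

  σ-mulVar : ∀ x p → σ (PX.mulVar x p) ≈P ρ x ⊗ σ p
  σ-mulVar x p = ≈P-trans (≡⇒≈P lhs) (≈P-trans (↭⇒≈P (concatMap-comm-↭ _ p (ρ x)))
       (≈P-trans (≋⇒≈P (≋-concatMap _ _ (ρ x) λ t → ≋-concatMap _ _ p λ bm → ≋-map _ _ (σᵐ (proj₂ bm)) λ u →
          *-left-comm _ _ _ , ↭-refl))
       (≡⇒≈P (PE.sym rhs))))
    where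
    lhs : σ (PX.mulVar x p) ≡ concatMap (λ bm → concatMap (λ t → map (λ u → scaleTerm (proj₁ bm) (t ·ₜ u)) (σᵐ (proj₂ bm))) (ρ x)) p
    lhs = PE.trans (ListP.concatMap-map _ _ p) (ListP.concatMap-cong (λ bm →
            PE.trans (ListP.map-concatMap (scaleTerm (proj₁ bm)) (λ t → map (t ·ₜ_) (σᵐ (proj₂ bm))) (ρ x))
                     (ListP.concatMap-cong (λ t → PE.sym (ListP.map-∘ (σᵐ (proj₂ bm)))) (ρ x))) p)
    rhs : ρ x ⊗ σ p ≡ concatMap (λ t → concatMap (λ bm → map (λ u → t ·ₜ scaleTerm (proj₁ bm) u) (σᵐ (proj₂ bm))) p) (ρ x)
    rhs = ListP.concatMap-cong (λ t → PE.trans (ListP.map-concatMap (t ·ₜ_) (λ bm → scale (proj₁ bm) (σᵐ (proj₂ bm))) p)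
            (ListP.concatMap-cong (λ bm → PE.sym (ListP.map-∘ (σᵐ (proj₂ bm)))) p)) (ρ x)

  σ-two : ∀ x y → σ ((1# , x ∷ y ∷ []) ∷ []) ≈P ρ x ⊗ ρ y
  σ-two x y = ≈P-trans (≡⇒≈P (ListP.++-identityʳ _)) (≈P-trans (≋⇒≈P (scale-1 _)) (≈P-⊗ʳ (ρ x) (≋⇒≈P (⊗-oneP (ρ y)))))

  σ-booleanAxiom : ∀ x → σ (PX.booleanAxiom x) ≈P ρ x ⊗ ρ x ++ scale (- 1#) (ρ x)
  σ-booleanAxiom x = ≈P-++ (≈P-trans (≋⇒≈P (scale-1 _)) (≈P-⊗ʳ (ρ x) (≋⇒≈P (⊗-oneP (ρ x)))))
                          (≈P-trans (≡⇒≈P (ListP.++-identityʳ _)) (≈P-scale (- 1#) (≋⇒≈P (⊗-oneP (ρ x)))))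

  module ByDegreeTwo (ρ-short : ∀ x → Short 3 (ρ x)) where

    Short-σᵐ : ∀ m → Short (suc (2 ℕ.* length m)) (σᵐ m)
    Short-σᵐ [] = ℕP.≤-refl ∷ []
    Short-σᵐ (x ∷ m) = Short-mono (s≤s (ℕP.≤-reflexive (PE.sym (ℕP.*-suc 2 (length m))))) (Short-⊗ (ρ-short x) (Short-σᵐ m))

    Short-σ-truncate : ∀ e p → Short (suc (2 ℕ.* e)) (σ (PX.truncate (suc e) p))
    Short-σ-truncate e [] = []
    Short-σ-truncate e ((a , m) ∷ p) with length m ℕ.<ᵇ suc e in eq
    ... | true = AllP.++⁺ (Short-scale a (σᵐ m) (Short-mono (s≤s (ℕP.*-monoʳ-≤ 2 m≤e)) (Short-σᵐ m))) (Short-σ-truncate e p)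
      where m≤e = ℕP.≤-pred (ℕP.<ᵇ⇒< (length m) (suc e) (PE.subst T (PE.sym eq) tt))
    ... | false = Short-σ-truncate e p

    module Lift {a₁ a₂} (AxX : PX.Pol → Set a₁) (AxY : Pol → Set a₂) (d : ℕ) where
      open Derivations AxY (2 ℕ.* d)
      module DX = PX.Derivations AxX d

      Der-ρ⊗ : ∀ x {q} E → 2 ℕ.+ E ≤ suc (2 ℕ.* d) → DegLt E q → Der q → Der (ρ x ⊗ q)
      Der-ρ⊗ x {q} E le dg dq = go (ρ x) (ρ-short x)
        where
        go : ∀ p → Short 3 p → Der (p ⊗ q)
        go [] [] = Der-[]
        go (t ∷ p) (s ∷ ss) = PE.subst Der (PE.sym (PE.cong (_++ (p ⊗ q)) (map-·ₜ t q)))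
          (Der-++ (Der-scale (proj₁ t) (Der-prepend (proj₂ t) E (ℕP.≤-trans (ℕP.+-monoˡ-≤ E (ℕP.≤-pred s)) le) dg dq)) (go p ss))

      module _ (σ-booleanAxiom-Der : ∀ x → 2 ≤ d → Der (σ (PX.booleanAxiom x)))
               (σ-input-Der : ∀ {p} → AxX p → PX.DegLt (suc d) p → Der (σ p)) where

        σ-truncate : ∀ e p → PX.DegLt (suc e) p → σ (PX.truncate (suc e) p) ≈P σ p
        σ-truncate e p dg = σ-resp (PX.truncate-≈P (suc e) p dg)

        σ-mulVar-Der : ∀ x {p} → PX.DegLt d p → Der (σ p) → Der (ρ x ⊗ σ p)
        σ-mulVar-Der x {p} dg dσp = by-cases d refl
          where
          by-cases : ∀ e → e ≡ d → Der (ρ x ⊗ σ p)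
          by-cases zero refl = Der-zero (≈P-trans (≈P-⊗ʳ (ρ x) σp≈0) (≡⇒≈P (⊗-[] (ρ x))))
            where
            σp≈0 : σ p ≈P []
            σp≈0 = σ-resp {p = p} {q = []} (PX.mk≈ λ m → PX.getD dg m z≤n)
          by-cases (suc e) refl = Der-ρ⊗ x (suc (2 ℕ.* e)) (ℕP.≤-reflexive (PE.cong suc (PE.sym (ℕP.*-suc 2 e))))
                                    (DegLt-resp (σ-truncate e p dg) (Short⇒DegLt (Short-σ-truncate e p))) dσp

        -- A line of degree ≤ d may still list cancelling terms of higher degree; truncation removes
        -- them, so that the image of the line is short.
        σ-Der : ∀ {p} → PX.Derivable AxX d p → Der (σ (PX.truncate (suc d) p))
        σ-Der (PX.boolean x dg) =
          Der-resp (≈P-sym (σ-truncate d (PX.booleanAxiom x) (PX.mkD dg))) (σ-booleanAxiom-Der x (PX.DegLe-booleanAxiom x dg))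
        σ-Der (PX.input {p} ax dg) = Der-resp (≈P-sym (σ-truncate d p (PX.mkD dg))) (σ-input-Der ax (PX.mkD dg))
        σ-Der (PX.lin {p} {q} a b dp dq dg) =
          Der-resp (≈P-trans (≈P-sym (σ-linComb a (PX.truncate (suc d) p) b (PX.truncate (suc d) q)))
                   (≈P-trans (σ-resp (PX.≈P-linComb a b (PX.truncate-≈P (suc d) p (DX.Derivable-DegLt dp))
                                                         (PX.truncate-≈P (suc d) q (DX.Derivable-DegLt dq))))
                   (≈P-sym (σ-truncate d (PX.linComb a p b q) (PX.mkD dg)))))
            (Der-lin a b (σ-Der dp) (σ-Der dq))
        σ-Der (PX.mul {p} x dp dg) =
          Der-resp (≈P-trans (≈P-sym (σ-mulVar x p)) (≈P-sym (σ-truncate d (PX.mulVar x p) (PX.mkD dg))))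
            (σ-mulVar-Der x (PX.DegLt-mulVar⁻ x p (PX.mkD {p = PX.mulVar x p} dg))
              (Der-resp (σ-truncate d p (DX.Derivable-DegLt dp)) (σ-Der dp)))

        σ-Refutation : PX.Refutation AxX d → Refutation AxY (2 ℕ.* d)
        σ-Refutation (p , dp , p≈1) with Der-resp σp≈1 (σ-Der dp)
          where
          σp≈1 : σ (PX.truncate (suc d) p) ≈P oneP
          σp≈1 = ≈P-trans (σ-truncate d p (DX.Derivable-DegLt dp)) (≈P-trans (σ-resp {p = p} {q = PX.oneP} (PX.mk≈ p≈1))
                   (mk≈ λ m → +-cong (onlyIf-cong (sameBag [] m) (*-identityˡ _)) ≈-refl))
        ... | inj₁ 1≈0 = ⊥-elim (1≉0 (≈-trans (≈-sym (+-identityʳ _)) (get 1≈0 [])))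
        ... | inj₂ (q , dq , q≈1) = q , dq , get q≈1

concatMap-singleton : ∀ (f : A → B) xs → concatMap (λ x → f x ∷ []) xs ≡ map f xs
concatMap-singleton f xs = PE.trans (PE.sym (ListP.concatMap-map (_∷ []) f xs)) (ListP.concatMap-pure (map f xs))

module PigeonholeDerivations {c ℓ} (F : Field c ℓ) {nI nJ k : ℕ} (nbr : Fin nI → Fin k → Fin nJ) (D : ℕ) where
  Y : Set
  Y = Fin nI × Fin k
  open PolynomialFacts F (decPair (decFin nI) (decFin k)) public
  open Field F hiding (zero) renaming (refl to ≈-refl; sym to ≈-sym; trans to ≈-trans)
  open import Relation.Binary.Reasoning.Setoid setoid
  open Derivations (FPHP.FPHPEq F nbr) D public
  open FPHP F nbr using (pigeon; func; hole)

  Conflict : Y → Y → Set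
  Conflict (i , a) (i′ , a′) = (i ≡ i′ × a ≢ a′) ⊎ (i ≢ i′ × nbr i a ≡ nbr i′ a′)

  Conflict-≢ : ∀ y y′ → Conflict y y′ → y ≢ y′
  Conflict-≢ _ _ (inj₁ (_ , ne)) refl = ne refl
  Conflict-≢ _ _ (inj₂ (ne , _)) refl = ne refl

  Conflicting : Mono → Set
  Conflicting m = ∃ λ y → ∃ λ y′ → y ∈ m × y′ ∈ m × Conflict y y′

  Conflicting-↭ : ∀ {m m′} → m ↭ m′ → Conflicting m → Conflicting m′
  Conflicting-↭ p (y , y′ , y∈ , y′∈ , cf) = y , y′ , ∈-resp-↭ p y∈ , ∈-resp-↭ p y′∈ , cf

  sameHole-Conflicting : ∀ {i i′ a a′ m} → (i , a) ∈ m → (i′ , a′) ∈ m → i ≢ i′ → nbr i a ≡ nbr i′ a′ → Conflicting m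
  sameHole-Conflicting p q i≢i′ same = _ , _ , p , q , inj₂ (i≢i′ , same)

  twoHoles-Conflicting : ∀ {i a a′} m → (i , a) ∈ m → (i , a′) ∈ m → a ≢ a′ → Conflicting m
  twoHoles-Conflicting m p q ne = _ , _ , p , q , inj₁ (refl , ne)

  Der-Conflict : ∀ y y′ → Conflict y y′ → 2 ≤ D → Der ((1# , y ∷ y′ ∷ []) ∷ [])
  Der-Conflict (i , a) (i′ , a′) (inj₁ (refl , ne)) le =
    Der-input (func i a a′ ne) (DegLt-mono (s≤s le) (Short⇒DegLt (ℕP.≤-refl ∷ [])))
  Der-Conflict (i , a) (i′ , a′) (inj₂ (ne , e)) le =
    Der-input (hole i i′ a a′ ne e) (DegLt-mono (s≤s le) (Short⇒DegLt (ℕP.≤-refl ∷ [])))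

  ∈-∈-↭ : ∀ {y y′ m} → y ∈ m → y′ ∈ m → y ≢ y′ → ∃ λ rest → m ↭ y ∷ y′ ∷ rest
  ∈-∈-↭ {y} {y′} {m} y∈ y′∈ ne with removeOne-complete y m y∈
  ... | m₁ , e₁ with ∈-resp-↭ (removeOne-sound y m e₁) y′∈
  ...   | here eq = ⊥-elim (ne (PE.sym eq))
  ...   | there y′∈m₁ with removeOne-complete y′ m₁ y′∈m₁
  ...     | m₂ , e₂ = m₂ , ↭-trans (removeOne-sound y m e₁) (prep y (removeOne-sound y′ m₁ e₂))

  Der-Conflicting : ∀ γ m → Conflicting m → length m ≤ D → Der ((γ , m) ∷ [])
  Der-Conflicting γ m (y , y′ , y∈ , y′∈ , cf) le with ∈-∈-↭ y∈ y′∈ (Conflict-≢ y y′ cf)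
  ... | rest , perm = Der-resp (≋⇒≈P ((*-identityʳ γ , ↭-trans (++-comm rest (y ∷ y′ ∷ [])) (↭-sym perm)) ∷ []))
         (Der-scale γ (Der-prepend rest 3 rest+3≤ (Short⇒DegLt (ℕP.≤-refl ∷ [])) (Der-Conflict y y′ cf 2≤D)))
    where
    length-m : length m ≡ suc (suc (length rest))
    length-m = ↭-length perm
    rest+3≤ : length rest ℕ.+ 3 ≤ suc D
    rest+3≤ = PE.subst (_≤ suc D) (PE.trans (PE.cong suc length-m) (PE.sym (ℕP.+-comm (length rest) 3))) (s≤s le)
    2≤D : 2 ≤ D
    2≤D = ℕP.≤-trans (s≤s (s≤s z≤n)) (PE.subst (_≤ D) length-m le)

  Vanishes : Carrier × Mono → Set ℓ
  Vanishes t = proj₁ t ≈ 0# ⊎ Conflicting (proj₂ t)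

  Vanishes-swap : ∀ t s → Vanishes (t ·ₜ s) → Vanishes (s ·ₜ t)
  Vanishes-swap t s (inj₁ z) = inj₁ (≈-trans (*-comm _ _) z)
  Vanishes-swap t s (inj₂ b) = inj₂ (Conflicting-↭ (++-comm (proj₂ t) (proj₂ s)) b)

  Der-Vanishes : ∀ p → All Vanishes p → Short (suc D) p → Der p
  Der-Vanishes [] [] [] = Der-[]
  Der-Vanishes ((γ , m) ∷ p) (v ∷ vs) (s ∷ ss) = Der-++ {(γ , m) ∷ []} (head v) (Der-Vanishes p vs ss)
    where
    head : Vanishes (γ , m) → Der ((γ , m) ∷ [])
    head (inj₁ γ≈0) = Der-zero (mk≈ λ n → ≈-trans (+-cong (onlyIf-cong (sameBag m n) γ≈0) ≈-refl)
                                           (≈-trans (+-identityʳ _) (onlyIf-0 (sameBag m n))))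
    head (inj₂ b) = Der-Conflicting γ m b (ℕP.≤-pred s)

  CrossVanishes : Pol → Pol → Set (c ⊔ ℓ)
  CrossVanishes p q = All (λ t → All (λ s → Vanishes (t ·ₜ s)) q) p

  CrossVanishes-sym : ∀ p q → CrossVanishes p q → CrossVanishes q p
  CrossVanishes-sym p [] _ = []
  CrossVanishes-sym p (s ∷ q) cr = All.map (λ { (v ∷ _) → Vanishes-swap _ s v }) cr ∷ CrossVanishes-sym p q (All.map All.tail cr)

  Der-⊗ : ∀ p q → Short 3 p → Short 3 q → 4 ≤ D → CrossVanishes p q → Der (p ⊗ q)
  Der-⊗ [] q sp sq le cr = Der-[]
  Der-⊗ (t ∷ p) q (s ∷ sp) sq le (c₁ ∷ cr) =
    Der-++ (Der-Vanishes (map (t ·ₜ_) q) (AllP.map⁺ c₁) (Short-mono (s≤s le) (Short-map-·ₜ t q s sq))) (Der-⊗ p q sp sq le cr)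

  BooleanTerm : Carrier × Mono → Set (c ⊔ ℓ)
  BooleanTerm t = (proj₁ t * proj₁ t ≈ proj₁ t) × Der ((1# , proj₂ t ++ proj₂ t) ∷ (- 1# , proj₂ t) ∷ [])

  square-∷-↭ : ∀ t p → (t ∷ p) ⊗ (t ∷ p) ++ scale (- 1#) (t ∷ p) ↭
    (t ·ₜ t ∷ scaleTerm (- 1#) t ∷ []) ++ (map (t ·ₜ_) p ++ (map (_·ₜ t) p ++ (p ⊗ p ++ scale (- 1#) p)))
  square-∷-↭ t p = prep (t ·ₜ t) (↭-trans (shift (scaleTerm (- 1#) t) (tp ++ pt∷pp) -p)
      (prep (scaleTerm (- 1#) t) (↭-trans (↭-reflexive (ListP.++-assoc tp pt∷pp -p))
        (++⁺ˡ tp (↭-trans (++⁺ʳ -p (concatMap-++-↭ (λ s → (s ·ₜ t) ∷ []) (λ s → map (s ·ₜ_) p) p))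
          (↭-reflexive (PE.trans (ListP.++-assoc _ (p ⊗ p) -p)
                                 (PE.cong (_++ (p ⊗ p ++ -p)) (concatMap-singleton (_·ₜ t) p)))))))))
    where
    tp = map (t ·ₜ_) p
    pt∷pp = concatMap (λ s → (s ·ₜ t) ∷ map (s ·ₜ_) p) p
    -p = scale (- 1#) p

  Der-square : ∀ p → Short 3 p → 4 ≤ D → All BooleanTerm p → AllPairs (λ t s → Vanishes (t ·ₜ s)) p →
               Der (p ⊗ p ++ scale (- 1#) p)
  Der-square [] [] le [] [] = Der-[]
  Der-square (t ∷ p) (st ∷ sp) le ((idem , Der-t) ∷ bts) (vs ∷ vss) =
    Der-resp (≈P-sym (↭⇒≈P (square-∷-↭ t p)))
      (Der-++ {t ·ₜ t ∷ scaleTerm (- 1#) t ∷ []} Der-tt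
        (Der-++ (Der-Vanishes _ (AllP.map⁺ vs) (Short-mono (s≤s le) (Short-map-·ₜ t p st sp)))
          (Der-++ (Der-Vanishes _ (AllP.map⁺ (All.map (Vanishes-swap t _) vs)) (Short-mono (s≤s le) (Short-map-·ₜʳ t p st sp)))
            (Der-square p sp le bts vss))))
    where
    Der-tt : Der (t ·ₜ t ∷ scaleTerm (- 1#) t ∷ [])
    Der-tt = Der-resp (≋⇒≈P ((≈-trans (*-identityʳ _) (≈-sym idem) , ↭-refl) ∷ (*-comm _ _ , ↭-refl) ∷ []))
               (Der-scale (proj₁ t) Der-t)

  BooleanTerm-const : ∀ a → a * a ≈ a → BooleanTerm (a , [])
  BooleanTerm-const a idem = idem , Der-zero (mk≈ λ n → begin
    onlyIf (sameBag [] n) 1# + (onlyIf (sameBag [] n) (- 1#) + 0#) ≈⟨ ≈-sym (+-assoc _ _ _) ⟩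
    (onlyIf (sameBag [] n) 1# + onlyIf (sameBag [] n) (- 1#)) + 0# ≈⟨ +-cong (≈-sym (onlyIf-+ (sameBag [] n) 1# (- 1#))) ≈-refl ⟩
    onlyIf (sameBag [] n) (1# + - 1#) + 0#                      ≈⟨ +-cong (onlyIf-cong (sameBag [] n) (-‿inverseʳ 1#)) ≈-refl ⟩
    onlyIf (sameBag [] n) 0# + 0#                               ≈⟨ +-identityʳ _ ⟩
    onlyIf (sameBag [] n) 0#                                    ≈⟨ onlyIf-0 (sameBag [] n) ⟩
    0#                                                          ∎)

  pair-booleanAxioms : ∀ y₁ y₂ → mulVar y₂ (mulVar y₂ (booleanAxiom y₁)) ++ mulVar y₁ (booleanAxiom y₂)
                                   ≈P (1# , y₁ ∷ y₂ ∷ y₁ ∷ y₂ ∷ []) ∷ (- 1# , y₁ ∷ y₂ ∷ []) ∷ []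
  pair-booleanAxioms y₁ y₂ = ≈P-trans (≋⇒≈P ((≈-refl , p₁) ∷ (≈-refl , p₂) ∷ (≈-refl , ↭-refl) ∷ (≈-refl , ↭-refl) ∷ []))
                                      (mk≈ cancel)
    where
    p₁ : y₂ ∷ y₂ ∷ y₁ ∷ y₁ ∷ [] ↭ y₁ ∷ y₂ ∷ y₁ ∷ y₂ ∷ []
    p₁ = ↭-trans (prep y₂ (swap y₂ y₁ ↭-refl)) (↭-trans (swap y₂ y₁ ↭-refl) (prep y₁ (prep y₂ (swap y₂ y₁ ↭-refl))))
    p₂ : y₂ ∷ y₂ ∷ y₁ ∷ [] ↭ y₁ ∷ y₂ ∷ y₂ ∷ []
    p₂ = ↭-trans (prep y₂ (swap y₂ y₁ ↭-refl)) (swap y₂ y₁ ↭-refl)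
    m₃ = y₁ ∷ y₂ ∷ y₂ ∷ []
    cancel : ∀ n → coeff ((1# , y₁ ∷ y₂ ∷ y₁ ∷ y₂ ∷ []) ∷ (- 1# , m₃) ∷ (1# , m₃) ∷ (- 1# , y₁ ∷ y₂ ∷ []) ∷ []) n
                 ≈ coeff ((1# , y₁ ∷ y₂ ∷ y₁ ∷ y₂ ∷ []) ∷ (- 1# , y₁ ∷ y₂ ∷ []) ∷ []) n
    cancel n = +-cong ≈-refl (≈-trans (≈-sym (+-assoc _ _ _)) (≈-trans (+-cong (≈-trans (≈-sym (onlyIf-+ (sameBag m₃ n) _ _))
                 (≈-trans (onlyIf-cong (sameBag m₃ n) (-‿inverseˡ 1#)) (onlyIf-0 (sameBag m₃ n)))) ≈-refl) (+-identityˡ _)))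

  BooleanTerm-pair : ∀ a y₁ y₂ → a * a ≈ a → 4 ≤ D → BooleanTerm (a , y₁ ∷ y₂ ∷ [])
  BooleanTerm-pair a y₁ y₂ idem le = idem , Der-resp (pair-booleanAxioms y₁ y₂)
      (Der-++ (Der-mulVar y₂ (deg ℕP.≤-refl (ℕP.≤-refl ∷ s≤s (s≤s (s≤s z≤n)) ∷ []))
                 (Der-mulVar y₂ (deg (ℕP.n≤1+n 3) (ℕP.≤-refl ∷ s≤s (s≤s z≤n) ∷ [])) (Der-booleanAxiom y₁ 2≤D)))
              (Der-mulVar y₁ (deg (ℕP.n≤1+n 3) (ℕP.≤-refl ∷ s≤s (s≤s z≤n) ∷ [])) (Der-booleanAxiom y₂ 2≤D)))
    where
    2≤D : 2 ≤ D
    2≤D = ℕP.≤-trans (s≤s (s≤s z≤n)) le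
    deg : ∀ {E p} → E ≤ 4 → Short E p → DegLt D p
    deg E≤4 s = DegLt-mono (ℕP.≤-trans E≤4 le) (Short⇒DegLt s)

  open import Algebra.Properties.Monoid.Sum +-monoid using (sum; sum-replicate-zero)

  δ : Fin k → Fin k → Carrier
  δ u j = if does (u ≟F j) then 1# else 0#

  δ-idem : ∀ u j → δ u j * δ u j ≈ δ u j
  δ-idem u j with does (u ≟F j)
  ... | true = *-identityˡ 1#
  ... | false = zeroˡ 0#

  δ-≢ˡ : ∀ u v j → u ≢ v → δ u j * δ v j ≈ 0#
  δ-≢ˡ u v j ne with u ≟F j | v ≟F j
  ... | yes refl | yes refl = ⊥-elim (ne refl)
  ... | yes _ | no _ = zeroʳ 1#
  ... | no _ | _ = zeroˡ _

  δ-≢ʳ : ∀ u j j′ → j ≢ j′ → δ u j * δ u j′ ≈ 0#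
  δ-≢ʳ u j j′ ne with u ≟F j | u ≟F j′
  ... | yes refl | yes refl = ⊥-elim (ne refl)
  ... | yes _ | no _ = zeroʳ 1#
  ... | no _ | _ = zeroˡ _

  sum-δ : ∀ {n} (u : Fin n) → sum (λ j → if does (u ≟F j) then 1# else 0#) ≈ 1#
  sum-δ {suc n} zero = ≈-trans (+-cong ≈-refl (sum-replicate-zero n)) (+-identityʳ 1#)
  sum-δ {suc n} (suc u) = ≈-trans (+-identityˡ _) (sum-δ u)

  foldr-tabulate : ∀ {n} (f : Fin n → Fin k) (φ : Fin k → Carrier) →
    foldr (λ j acc → φ j + acc) 0# (tabulate f) ≡ sum (φ ∘ f)
  foldr-tabulate {zero} f φ = refl
  foldr-tabulate {suc n} f φ = PE.cong (φ (f zero) +_) (foldr-tabulate (f ∘ suc) φ)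

  coeff-singletons : ∀ {A : Set} (φ : A → Carrier) m xs n →
    coeff (concatMap (λ x → (φ x , m) ∷ []) xs) n ≈ onlyIf (sameBag m n) (foldr (λ x acc → φ x + acc) 0# xs)
  coeff-singletons φ m [] n = ≈-sym (onlyIf-0 (sameBag m n))
  coeff-singletons φ m (x ∷ xs) n =
    ≈-trans (+-cong ≈-refl (coeff-singletons φ m xs n)) (≈-sym (onlyIf-+ (sameBag m n) _ _))

  concatMap-δ : ∀ u m → concatMap (λ j → (δ u j , m) ∷ []) (allFin k) ≈P (1# , m) ∷ []
  concatMap-δ u m = mk≈ λ n → ≈-trans (coeff-singletons (δ u) m (allFin k) n)
      (≈-trans (onlyIf-cong (sameBag m n) (≈-trans (reflexive (foldr-tabulate (λ j → j) (δ u))) (sum-δ u)))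
               (≈-sym (+-identityʳ _)))

  -- "The colour f a b is j", where a and b index the edges chosen by the pigeons i and i′.
  colourOfPair : Fin nI → Fin nI → (Fin k → Fin k → Fin k) → Fin k → Pol
  colourOfPair i i′ f j = concatMap (λ a → map (λ b → (δ (f a b) j , (i , a) ∷ (i′ , b) ∷ [])) (allFin k)) (allFin k)

  colourConst : Fin k → Fin k → Pol
  colourConst col j = (δ col j , []) ∷ []

  pairProducts : Fin nI → Fin nI → Pol
  pairProducts i i′ = concatMap (λ a → map (λ b → (1# , (i , a) ∷ (i′ , b) ∷ [])) (allFin k)) (allFin k)

  ↭-concatMap : ∀ {A : Set} {f g : A → Pol} xs → (∀ x → f x ↭ g x) → concatMap f xs ↭ concatMap g xs
  ↭-concatMap [] f↭g = ↭-refl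
  ↭-concatMap (x ∷ xs) f↭g = ++⁺ (f↭g x) (↭-concatMap xs f↭g)

  concatMap-colourOfPair : ∀ i i′ f → concatMap (colourOfPair i i′ f) (allFin k) ≈P pairProducts i i′
  concatMap-colourOfPair i i′ f =
    ≈P-trans (↭⇒≈P (↭-trans (↭-concatMap (allFin k) (λ j → ↭-concatMap (allFin k) (λ a → ↭-reflexive (PE.sym (concatMap-singleton _ (allFin k))))))
      (↭-trans (concatMap-comm-↭ (λ j a → concatMap (λ b → term j a b ∷ []) (allFin k)) (allFin k) (allFin k))
        (↭-concatMap (allFin k) (λ a → concatMap-comm-↭ (λ j b → term j a b ∷ []) (allFin k) (allFin k))))))
    (≈P-trans (≈P-concatMap (allFin k) (λ a → ≈P-concatMap (allFin k) (λ b → concatMap-δ (f a b) ((i , a) ∷ (i′ , b) ∷ []))))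
      (≡⇒≈P (ListP.concatMap-cong (λ a → concatMap-singleton _ (allFin k)) (allFin k))))
    where
    term : Fin k → Fin k → Fin k → Carrier × Mono
    term j a b = (δ (f a b) j , (i , a) ∷ (i′ , b) ∷ [])

  concatMap-colourConst : ∀ col → concatMap (colourConst col) (allFin k) ++ constP (- 1#) ≈P []
  concatMap-colourConst col = ≈P-trans (≈P-++ (concatMap-δ col []) ≈P-refl) (≈P-trans (↭⇒≈P (swap _ _ ↭-refl))
    (≈P-trans (≋⇒≈P ((≈-sym (*-identityʳ _) , ↭-refl) ∷ ≋-refl _)) (neg-++-cancel ((1# , []) ∷ []))))

  pigeonAxiom : Fin nI → Pol
  pigeonAxiom i = map (λ c → (1# , (i , c) ∷ [])) (allFin k) ++ constP (- 1#)

  Short-pigeonAxiom : ∀ i → Short 2 (pigeonAxiom i)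
  Short-pigeonAxiom i = AllP.++⁺ (AllP.map⁺ (All.universal (λ _ → ℕP.≤-refl) (allFin k))) (s≤s z≤n ∷ [])

  Der-pigeonAxiom : ∀ i → 1 ≤ D → Der (pigeonAxiom i)
  Der-pigeonAxiom i le = Der-input (pigeon i) (DegLt-mono (s≤s le) (Short⇒DegLt (Short-pigeonAxiom i)))

  pigeonAxiom-product : ∀ i i′ →
    concatMap (λ b → mulVar (i′ , b) (pigeonAxiom i)) (allFin k) ++ pigeonAxiom i′ ≈P pairProducts i i′ ++ constP (- 1#)
  pigeonAxiom-product i i′ =
    ≈P-trans (≡⇒≈P (PE.cong (_++ pigeonAxiom i′) (ListP.concatMap-cong mulVar-pigeonAxiom (allFin k))))
    (≈P-trans (↭⇒≈P (++⁺ʳ (pigeonAxiom i′) (concatMap-++-↭ U V (allFin k))))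
    (≈P-trans (≡⇒≈P (PE.trans (ListP.++-assoc (concatMap U (allFin k)) (concatMap V (allFin k)) (pigeonAxiom i′))
                              (PE.cong (concatMap U (allFin k) ++_) (PE.sym (ListP.++-assoc (concatMap V (allFin k)) Σp′ (constP (- 1#)))))))
    (≈P-++ ΣU≈pairProducts (≈P-++ (≈P-trans (≈P-++ (≋⇒≈P ΣV≋-Σp′) ≈P-refl) (neg-++-cancel Σp′)) ≈P-refl))))
    where
    U V : Fin k → Pol
    U b = map (λ a → (1# , (i′ , b) ∷ (i , a) ∷ [])) (allFin k)
    V b = (- 1# , (i′ , b) ∷ []) ∷ []
    Σp′ = map (λ b → (1# , (i′ , b) ∷ [])) (allFin k)
    mulVar-pigeonAxiom : ∀ b → mulVar (i′ , b) (pigeonAxiom i) ≡ U b ++ V b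
    mulVar-pigeonAxiom b = PE.trans (ListP.map-++ _ (map (λ c → (1# , (i , c) ∷ [])) (allFin k)) (constP (- 1#)))
                             (PE.cong (_++ V b) (PE.sym (ListP.map-∘ (allFin k))))
    ΣU≈pairProducts : concatMap U (allFin k) ≈P pairProducts i i′
    ΣU≈pairProducts =
      ≈P-trans (↭⇒≈P (↭-trans (↭-concatMap (allFin k) (λ b → ↭-reflexive (PE.sym (concatMap-singleton _ (allFin k)))))
                   (concatMap-comm-↭ (λ b a → (1# , (i′ , b) ∷ (i , a) ∷ []) ∷ []) (allFin k) (allFin k))))
      (≈P-trans (≋⇒≈P (≋-concatMap _ _ (allFin k) (λ a → ≋-concatMap _ _ (allFin k) (λ b → (≈-refl , swap (i′ , b) (i , a) ↭-refl) ∷ []))))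
      (≡⇒≈P (ListP.concatMap-cong (λ a → concatMap-singleton _ (allFin k)) (allFin k))))
    ΣV≋-Σp′ : concatMap V (allFin k) ≋ scale (- 1#) Σp′
    ΣV≋-Σp′ = ≋-trans (≡⇒≋ (concatMap-singleton (λ b → (- 1# , (i′ , b) ∷ [])) (allFin k)))
               (≋-trans (≋-map _ _ (allFin k) (λ b → ≈-sym (*-identityʳ (- 1#)) , ↭-refl)) (≡⇒≋ (ListP.map-∘ (allFin k))))

  Der-pairProducts : ∀ i i′ → 2 ≤ D → Der (pairProducts i i′ ++ constP (- 1#))
  Der-pairProducts i i′ le = Der-resp (pigeonAxiom-product i i′)
    (Der-++ (Der-concatMap (λ b → mulVar (i′ , b) (pigeonAxiom i)) (allFin k)
               (λ b → Der-mulVar (i′ , b) (DegLt-mono le (Short⇒DegLt (Short-pigeonAxiom i))) (Der-pigeonAxiom i 1≤D)))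
            (Der-pigeonAxiom i′ 1≤D))
    where
    1≤D = ℕP.≤-trans (s≤s z≤n) le

  All-colourOfPair : ∀ {p} {P : Carrier × Mono → Set p} i i′ f j →
    (∀ a b → P (δ (f a b) j , (i , a) ∷ (i′ , b) ∷ [])) → All P (colourOfPair i i′ f j)
  All-colourOfPair i i′ f j P-ab =
    AllP.concat⁺ (AllP.map⁺ (All.universal (λ a → AllP.map⁺ (All.universal (P-ab a) (allFin k))) (allFin k)))

  Short-colourOfPair : ∀ i i′ f j → Short 3 (colourOfPair i i′ f j)
  Short-colourOfPair i i′ f j = All-colourOfPair i i′ f j (λ _ _ → ℕP.≤-refl)

  CrossVanishes-colourOfPair : ∀ i i′ i₂ i₂′ f g j →
    (∀ a b a′ b′ → Conflicting ((i , a) ∷ (i′ , b) ∷ (i₂ , a′) ∷ (i₂′ , b′) ∷ []) ⊎ f a b ≢ g a′ b′) →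
    CrossVanishes (colourOfPair i i′ f j) (colourOfPair i₂ i₂′ g j)
  CrossVanishes-colourOfPair i i′ i₂ i₂′ f g j H =
    All-colourOfPair i i′ f j λ a b → All-colourOfPair i₂ i₂′ g j λ a′ b′ → vanishes a b a′ b′
    where
    vanishes : ∀ a b a′ b′ → Vanishes ((δ (f a b) j , (i , a) ∷ (i′ , b) ∷ []) ·ₜ (δ (g a′ b′) j , (i₂ , a′) ∷ (i₂′ , b′) ∷ []))
    vanishes a b a′ b′ with H a b a′ b′
    ... | inj₁ cf = inj₂ cf
    ... | inj₂ ne = inj₁ (δ-≢ˡ (f a b) (g a′ b′) j ne)

  CrossVanishes-colourOfPair-const : ∀ i i′ f col j → (∀ a b → Conflicting ((i , a) ∷ (i′ , b) ∷ []) ⊎ f a b ≢ col) →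
    CrossVanishes (colourOfPair i i′ f j) (colourConst col j)
  CrossVanishes-colourOfPair-const i i′ f col j H = All-colourOfPair i i′ f j λ a b → vanishes a b ∷ []
    where
    vanishes : ∀ a b → Vanishes ((δ (f a b) j , (i , a) ∷ (i′ , b) ∷ []) ·ₜ (δ col j , []))
    vanishes a b with H a b
    ... | inj₁ cf = inj₂ cf
    ... | inj₂ ne = inj₁ (δ-≢ˡ (f a b) col j ne)

  CrossVanishes-colourConst : ∀ col col′ j → col ≢ col′ → CrossVanishes (colourConst col j) (colourConst col′ j)
  CrossVanishes-colourConst col col′ j ne = (inj₁ (δ-≢ˡ col col′ j ne) ∷ []) ∷ []

  repeatedPair-Conflicting : ∀ i i′ a b a′ b′ → a ≢ a′ ⊎ b ≢ b′ →
    Conflicting ((i , a) ∷ (i′ , b) ∷ (i , a′) ∷ (i′ , b′) ∷ [])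
  repeatedPair-Conflicting i i′ a b a′ b′ (inj₁ ne) = twoHoles-Conflicting _ (here refl) (there (there (here refl))) ne
  repeatedPair-Conflicting i i′ a b a′ b′ (inj₂ ne) =
    twoHoles-Conflicting _ (there (here refl)) (there (there (there (here refl)))) ne

  CrossVanishes-colourOfPair-≢ : ∀ i i′ f j j′ → j ≢ j′ → CrossVanishes (colourOfPair i i′ f j) (colourOfPair i i′ f j′)
  CrossVanishes-colourOfPair-≢ i i′ f j j′ ne =
    All-colourOfPair i i′ f j λ a b → All-colourOfPair i i′ f j′ λ a′ b′ → vanishes a b a′ b′
    where
    vanishes : ∀ a b a′ b′ → Vanishes ((δ (f a b) j , (i , a) ∷ (i′ , b) ∷ []) ·ₜ (δ (f a′ b′) j′ , (i , a′) ∷ (i′ , b′) ∷ []))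
    vanishes a b a′ b′ with a ≟F a′ | b ≟F b′
    ... | yes refl | yes refl = inj₁ (δ-≢ʳ (f a b) j j′ ne)
    ... | no a≢a′ | _ = inj₂ (repeatedPair-Conflicting i i′ a b a′ b′ (inj₁ a≢a′))
    ... | yes _ | no b≢b′ = inj₂ (repeatedPair-Conflicting i i′ a b a′ b′ (inj₂ b≢b′))

  CrossVanishes-colourConst-≢ : ∀ col j j′ → j ≢ j′ → CrossVanishes (colourConst col j) (colourConst col j′)
  CrossVanishes-colourConst-≢ col j j′ ne = (inj₁ (δ-≢ʳ col j j′ ne) ∷ []) ∷ []

  Der-square-colourOfPair : ∀ i i′ f j → 4 ≤ D →
    Der (colourOfPair i i′ f j ⊗ colourOfPair i i′ f j ++ scale (- 1#) (colourOfPair i i′ f j))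
  Der-square-colourOfPair i i′ f j le = Der-square (colourOfPair i i′ f j) (Short-colourOfPair i i′ f j) le
    (All-colourOfPair i i′ f j λ a b → BooleanTerm-pair _ _ _ (δ-idem (f a b) j) le)
    (AllPairs-concatMap-map _ (allFin⁺ k) (allFin⁺ k) λ a b a′ b′ ne → inj₂ (repeatedPair-Conflicting i i′ a b a′ b′ ne))

  Der-square-colourConst : ∀ col j → 4 ≤ D → Der (colourConst col j ⊗ colourConst col j ++ scale (- 1#) (colourConst col j))
  Der-square-colourConst col j le = Der-square _ (s≤s z≤n ∷ []) le (BooleanTerm-const _ (δ-idem col j) ∷ []) ([] ∷ [])

module ResidueLemmas where
  open import Data.Nat using (_+_; _*_; _%_; _/_; NonZero)
  open import Data.Nat.DivMod using (_mod_; m≡m%n+[m/n]*n; m%n<n; [m+kn]%n≡m%n; m<n⇒m%n≡m)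
  open import Data.Fin.Properties using (toℕ-fromℕ<; toℕ<n)
  open import Relation.Binary.Definitions using (tri<; tri≈; tri>)

  %-≡-/-<⇒+≤ : ∀ K .{{_ : NonZero K}} s t → s / K < t / K → s % K ≡ t % K → s + K ≤ t
  %-≡-/-<⇒+≤ K s t lt eq = begin
    s + K                                 ≡⟨ PE.cong (_+ K) (m≡m%n+[m/n]*n s K) ⟩
    (s % K + (s / K) * K) + K             ≡⟨ ℕP.+-assoc (s % K) _ K ⟩
    s % K + ((s / K) * K + K)             ≡⟨ PE.cong (s % K +_) (ℕP.+-comm _ K) ⟩
    s % K + suc (s / K) * K               ≤⟨ ℕP.+-monoʳ-≤ (s % K) (ℕP.*-monoˡ-≤ K lt) ⟩
    s % K + (t / K) * K                   ≡⟨ PE.cong (_+ (t / K) * K) eq ⟩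
    t % K + (t / K) * K                   ≡⟨ PE.sym (m≡m%n+[m/n]*n t K) ⟩
    t                                     ∎
    where open ℕP.≤-Reasoning

  %-injective-window : ∀ K .{{_ : NonZero K}} w s t → w ≤ s → w ≤ t → s < w + K → t < w + K → s % K ≡ t % K → s ≡ t
  %-injective-window K w s t w≤s w≤t s< t< eq with ℕP.<-cmp (s / K) (t / K)
  ... | tri≈ _ e _ = PE.trans (m≡m%n+[m/n]*n s K) (PE.trans (PE.cong₂ (λ a b → a + b * K) eq e) (PE.sym (m≡m%n+[m/n]*n t K)))
  ... | tri< lt _ _ = ⊥-elim (ℕP.<-irrefl refl (ℕP.<-≤-trans t< (ℕP.≤-trans (ℕP.+-monoˡ-≤ K w≤s) (%-≡-/-<⇒+≤ K s t lt eq))))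
  ... | tri> _ _ gt = ⊥-elim (ℕP.<-irrefl refl (ℕP.<-≤-trans s< (ℕP.≤-trans (ℕP.+-monoˡ-≤ K w≤t) (%-≡-/-<⇒+≤ K t s gt (PE.sym eq)))))

  mod-+-* : ∀ K .{{_ : NonZero K}} (c : Fin K) r m → m ≡ toℕ c + K * r → m mod K ≡ c
  mod-+-* K c r m e = toℕ-injective (PE.trans (toℕ-fromℕ< (m%n<n m K))
    (PE.trans (PE.cong (_% K) (PE.trans e (PE.cong (toℕ c +_) (ℕP.*-comm K r))))
      (PE.trans ([m+kn]%n≡m%n (toℕ c) r K) (m<n⇒m%n≡m (toℕ<n c)))))

  mod-≢-window : ∀ K .{{_ : NonZero K}} w s t → w ≤ s → w ≤ t → s < w + K → t < w + K → s ≢ t → s mod K ≢ t mod K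
  mod-≢-window K w s t w≤s w≤t s< t< s≢t e = s≢t (%-injective-window K w s t w≤s w≤t s< t<
    (PE.trans (PE.sym (toℕ-fromℕ< (m%n<n s K))) (PE.trans (PE.cong toℕ e) (toℕ-fromℕ< (m%n<n t K)))))

module ColourArrangements (n : ℕ) where
  open import Data.Fin.Permutation.Components using (transpose; transpose-inverse)
  open import Relation.Nullary.Decidable using (dec-true; dec-false)

  K : ℕ
  K = suc (suc (suc n))

  first last : Fin K
  first = zero
  last = fromℕ (suc (suc n))

  first≢last : first ≢ last
  first≢last ()

  other : Fin K → Fin K → Fin K
  other u v with u ≟F zero | v ≟F zero
  ... | no _ | no _ = zero
  ... | _ | _ with u ≟F suc zero | v ≟F suc zero
  ...   | no _ | no _ = suc zero
  ...   | _ | _ = suc (suc zero)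

  other-≢ : ∀ u v → other u v ≢ u × other u v ≢ v
  other-≢ u v with u ≟F zero | v ≟F zero
  ... | no u≢0 | no v≢0 = u≢0 ∘ PE.sym , v≢0 ∘ PE.sym
  ... | yes refl | _ with v ≟F suc zero
  ...   | no v≢1 = (λ ()) , v≢1 ∘ PE.sym
  ...   | yes refl = (λ ()) , (λ ())
  other-≢ u v | no _ | yes refl with u ≟F suc zero
  ...   | no u≢1 = u≢1 ∘ PE.sym , (λ ())
  ...   | yes refl = (λ ()) , (λ ())

  transpose-≡ˡ : ∀ (u v : Fin K) → transpose u v u ≡ v
  transpose-≡ˡ u v rewrite dec-true (u ≟F u) refl = refl

  transpose-≡ʳ : ∀ (u v : Fin K) → transpose u v v ≡ u
  transpose-≡ʳ u v with v ≟F u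
  ... | yes refl = refl
  ... | no _ rewrite dec-true (v ≟F v) refl = refl

  transpose-≢ : ∀ (u v w : Fin K) → w ≢ u → w ≢ v → transpose u v w ≡ w
  transpose-≢ u v w w≢u w≢v rewrite dec-false (w ≟F u) w≢u | dec-false (w ≟F v) w≢v = refl

  transpose-injective : ∀ (u v : Fin K) {w w′} → transpose u v w ≡ transpose u v w′ → w ≡ w′
  transpose-injective u v {w} {w′} e =
    PE.trans (PE.sym (transpose-inverse v u)) (PE.trans (PE.cong (transpose v u) e) (transpose-inverse v u))

  arrange : Fin K → Fin K → Fin K → Fin K
  arrange A B w = transpose B (transpose first A last) (transpose first A w)

  arrange-injective : ∀ A B {w w′} → arrange A B w ≡ arrange A B w′ → w ≡ w′
  arrange-injective A B e = transpose-injective first A (transpose-injective B _ e)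

  arrange-first : ∀ A B → A ≢ B → arrange A B first ≡ A
  arrange-first A B A≢B rewrite transpose-≡ˡ first A = transpose-≢ B _ A A≢B A≢last′
    where
    A≢last′ : A ≢ transpose first A last
    A≢last′ with A ≟F last
    ... | yes refl = λ e → first≢last (PE.sym (PE.trans e (transpose-≡ʳ first last)))
    ... | no A≢last = λ e → A≢last (PE.trans e (transpose-≢ first A last (first≢last ∘ PE.sym) (A≢last ∘ PE.sym)))

  arrange-last : ∀ A B → arrange A B last ≡ B
  arrange-last A B = transpose-≡ʳ B (transpose first A last)

  arrange-middle : ∀ A B a → A ≢ B → a ≢ first → a ≢ last → arrange A B a ≢ A × arrange A B a ≢ B
  arrange-middle A B a A≢B a≢first a≢last =
    (λ e → a≢first (arrange-injective A B (PE.trans e (PE.sym (arrange-first A B A≢B))))) ,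
    (λ e → a≢last (arrange-injective A B (PE.trans e (PE.sym (arrange-last A B)))))

  -- The colouring of H(i,i′,c,c′) when i chose its edge x and i′ its edge y.  The clique
  -- ℓ gets colour firstˡ at ℓ₁ (adjacent to pigeon i, coloured x), lastˡ at ℓ_k, and the
  -- other colours in the middle (adjacent to the vertex pre-coloured c); hence c is put
  -- at ℓ_k if x = c and at ℓ₁ otherwise.  Symmetrically for r.  The remaining end colours
  -- are chosen so that ℓ_k and r_k agree when identified (c ≢ c′) and differ when adjacent
  -- (c ≡ c′); this is possible unless x = c and y = c′.
  module Gadget (c c′ : Fin K) where
    spare₁ spare₂ spare₃ : Fin K
    spare₁ = other c c
    spare₂ = other c spare₁
    spare₃ = other c c′

    freeˡ freeʳ firstˡ lastˡ firstʳ lastʳ : Fin K → Fin K → Fin K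
    freeˡ x y = if does (c ≟F c′) then spare₁ else (if does (y ≟F c′) then c′ else spare₃)
    freeʳ x y = if does (c ≟F c′) then spare₂ else (if does (x ≟F c) then c else spare₃)
    firstˡ x y = if does (x ≟F c) then freeˡ x y else c
    lastˡ x y = if does (x ≟F c) then c else freeˡ x y
    firstʳ x y = if does (y ≟F c′) then freeʳ x y else c′
    lastʳ x y = if does (y ≟F c′) then c′ else freeʳ x y

    colourˡ colourʳ : Fin K → Fin K → Fin K → Fin K
    colourˡ a x y = arrange (firstˡ x y) (lastˡ x y) a
    colourʳ a x y = arrange (firstʳ x y) (lastʳ x y) a

    freeˡ≢c : ∀ x y → freeˡ x y ≢ c
    freeˡ≢c x y with c ≟F c′
    ... | yes _ = proj₁ (other-≢ c c)
    ... | no c≢c′ with y ≟F c′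
    ...   | yes _ = c≢c′ ∘ PE.sym
    ...   | no _ = proj₁ (other-≢ c c′)

    freeʳ≢c′ : ∀ x y → freeʳ x y ≢ c′
    freeʳ≢c′ x y with c ≟F c′
    ... | yes refl = proj₁ (other-≢ c spare₁)
    ... | no c≢c′ with x ≟F c
    ...   | yes _ = c≢c′
    ...   | no _ = proj₂ (other-≢ c c′)

    firstˡ≢lastˡ : ∀ x y → firstˡ x y ≢ lastˡ x y
    firstˡ≢lastˡ x y with x ≟F c
    ... | yes _ = freeˡ≢c x y
    ... | no _ = freeˡ≢c x y ∘ PE.sym

    firstʳ≢lastʳ : ∀ x y → firstʳ x y ≢ lastʳ x y
    firstʳ≢lastʳ x y with y ≟F c′
    ... | yes _ = freeʳ≢c′ x y
    ... | no _ = freeʳ≢c′ x y ∘ PE.sym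

    firstˡ≢x : ∀ x y → firstˡ x y ≢ x
    firstˡ≢x x y with x ≟F c
    ... | yes refl = freeˡ≢c x y
    ... | no x≢c = x≢c ∘ PE.sym

    firstʳ≢y : ∀ x y → firstʳ x y ≢ y
    firstʳ≢y x y with y ≟F c′
    ... | yes refl = freeʳ≢c′ x y
    ... | no y≢c′ = y≢c′ ∘ PE.sym

    c-at-endˡ : ∀ x y → c ≡ firstˡ x y ⊎ c ≡ lastˡ x y
    c-at-endˡ x y with x ≟F c
    ... | yes _ = inj₂ refl
    ... | no _ = inj₁ refl

    c′-at-endʳ : ∀ x y → c′ ≡ firstʳ x y ⊎ c′ ≡ lastʳ x y
    c′-at-endʳ x y with y ≟F c′
    ... | yes _ = inj₂ refl
    ... | no _ = inj₁ refl

    colourˡ-middle : ∀ a x y → a ≢ first → a ≢ last → colourˡ a x y ≢ c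
    colourˡ-middle a x y a≢first a≢last e with c-at-endˡ x y | arrange-middle (firstˡ x y) (lastˡ x y) a (firstˡ≢lastˡ x y) a≢first a≢last
    ... | inj₁ c≡ | (≢first , _) = ≢first (PE.trans e c≡)
    ... | inj₂ c≡ | (_ , ≢last) = ≢last (PE.trans e c≡)

    colourʳ-middle : ∀ a x y → a ≢ first → a ≢ last → colourʳ a x y ≢ c′
    colourʳ-middle a x y a≢first a≢last e with c′-at-endʳ x y | arrange-middle (firstʳ x y) (lastʳ x y) a (firstʳ≢lastʳ x y) a≢first a≢last
    ... | inj₁ c′≡ | (≢first , _) = ≢first (PE.trans e c′≡)
    ... | inj₂ c′≡ | (_ , ≢last) = ≢last (PE.trans e c′≡)

    colourˡ-first : ∀ x y → colourˡ first x y ≢ x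
    colourˡ-first x y e = firstˡ≢x x y (PE.trans (PE.sym (arrange-first _ _ (firstˡ≢lastˡ x y))) e)

    colourʳ-first : ∀ x y → colourʳ first x y ≢ y
    colourʳ-first x y e = firstʳ≢y x y (PE.trans (PE.sym (arrange-first _ _ (firstʳ≢lastʳ x y))) e)

    colourˡ-last : ∀ x y → colourˡ last x y ≡ lastˡ x y
    colourˡ-last x y = arrange-last (firstˡ x y) (lastˡ x y)

    colourʳ-last : ∀ x y → colourʳ last x y ≡ lastʳ x y
    colourʳ-last x y = arrange-last (firstʳ x y) (lastʳ x y)

    colourˡ-injective : ∀ a b x y → colourˡ a x y ≡ colourˡ b x y → a ≡ b
    colourˡ-injective a b x y = arrange-injective (firstˡ x y) (lastˡ x y)

    colourʳ-injective : ∀ a b x y → colourʳ a x y ≡ colourʳ b x y → a ≡ b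
    colourʳ-injective a b x y = arrange-injective (firstʳ x y) (lastʳ x y)

    lastˡ≡lastʳ : ∀ x y → c ≢ c′ → ¬ (x ≡ c × y ≡ c′) → lastˡ x y ≡ lastʳ x y
    lastˡ≡lastʳ x y c≢c′ not-hole with c ≟F c′
    ... | yes c≡c′ = ⊥-elim (c≢c′ c≡c′)
    ... | no _ with x ≟F c | y ≟F c′
    ...   | yes x≡c | yes y≡c′ = ⊥-elim (not-hole (x≡c , y≡c′))
    ...   | yes _ | no _ = refl
    ...   | no _ | yes _ = refl
    ...   | no _ | no _ = refl

    lastˡ≢lastʳ : ∀ x y → c ≡ c′ → ¬ (x ≡ c × y ≡ c′) → lastˡ x y ≢ lastʳ x y
    lastˡ≢lastʳ x y refl not-hole with c ≟F c
    ... | no c≢c = ⊥-elim (c≢c refl)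
    ... | yes _ with x ≟F c | y ≟F c
    ...   | yes x≡c | yes y≡c = ⊥-elim (not-hole (x≡c , y≡c))
    ...   | yes _ | no _ = proj₁ (other-≢ c spare₁) ∘ PE.sym
    ...   | no _ | yes _ = proj₁ (other-≢ c c)
    ...   | no _ | no _ = proj₂ (other-≢ c spare₁) ∘ PE.sym

module Reduction {c ℓ} (F : Field c ℓ) (n nI nJ : ℕ) (nbr : Fin nI → Fin (ColourArrangements.K n) → Fin nJ)
                 (M : ℕ) (key : GadgetIndex.PV nI (ColourArrangements.K n) → ℕ) (d : ℕ) where
  open ColourArrangements n
  open ResidueLemmas
  open Construction K nI nJ nbr M key
  open Field F hiding (zero) renaming (refl to ≈-refl; sym to ≈-sym; trans to ≈-trans)
  open import Data.Nat.DivMod using (_mod_)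

  X : Set
  X = V × Fin K

  _≟X_ : DecidableEquality X
  _≟X_ = decPair _≟V_ (decFin K)

  open PigeonholeDerivations F nbr (2 ℕ.* d)

  -- The pigeon vertex i is treated as the pair (i , i), so that its off-diagonal terms are
  -- functional axioms and every vertex is handled alike.
  data ColourRule : Set where
    byPair   : Fin nI → Fin nI → (Fin K → Fin K → Fin K) → ColourRule
    constant : Fin K → ColourRule

  module G (g : Gad) = Gadget (gc g) (gc′ g)

  rule : Pre → ColourRule
  rule (pig i) = byPair i i (λ x _ → x)
  rule (lv g a) = byPair (gi g) (gi′ g) (G.colourˡ g a)
  rule (rv g a) = byPair (gi g) (gi′ g) (G.colourʳ g a)
  rule (zv t) = constant (toℕ t mod K)

  colourIs : ColourRule → Fin K → Pol
  colourIs (byPair i i′ f) j = colourOfPair i i′ f j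
  colourIs (constant col) j = colourConst col j

  ρ : X → Pol
  ρ (v , j) = colourIs (rule (proj₁ v)) j

  ρ-short : ∀ x → Short 3 (ρ x)
  ρ-short (v , j) with rule (proj₁ v)
  ... | byPair i i′ f = Short-colourOfPair i i′ f j
  ... | constant col = s≤s z≤n ∷ []

  open Substitution F _≟X_ (decPair (decFin nI) (decFin K)) ρ

  colourAxiom : V → PX.Pol
  colourAxiom v = map (λ j → (1# , (v , j) ∷ [])) (allFin K) ++ PX.constP (- 1#)

  σ-colourAxiom : ∀ v → σ (colourAxiom v) ≈P concatMap (λ j → ρ (v , j)) (allFin K) ++ constP (- 1#)
  σ-colourAxiom v = ≈P-trans (≡⇒≈P (σ-++ (map (λ j → (1# , (v , j) ∷ [])) (allFin K)) (PX.constP (- 1#))))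
                              (≈P-++ (σ-singletons (allFin K)) σ-const)
    where
    σ-singletons : ∀ js → σ (map (λ j → (1# , (v , j) ∷ [])) js) ≈P concatMap (λ j → ρ (v , j)) js
    σ-singletons [] = ≈P-refl
    σ-singletons (j ∷ js) = ≈P-++ (≈P-trans (≋⇒≈P (scale-1 _)) (≋⇒≈P (⊗-oneP (ρ (v , j))))) (σ-singletons js)
    σ-const : σ (PX.constP (- 1#)) ≈P constP (- 1#)
    σ-const = ≈P-trans (≡⇒≈P (ListP.++-identityʳ _)) (≋⇒≈P ((*-identityʳ _ , ↭-refl) ∷ []))

  colourAxiom-degree : ∀ v → PX.DegLt (suc d) (colourAxiom v) → 1 ≤ d
  colourAxiom-degree v dg = PX.DegLe-∷ 1# ((v , zero) ∷ []) _ 1≉0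
    (AllP.++⁺ (AllP.map⁺ (AllP.tabulate⁺ λ j → PX.sameBag-false _ _ (suc≢zero j ∘ ↭-singleton-inv))) (refl ∷ []))
    (PX.getD dg)
    where
    suc≢zero : ∀ j → (v , suc j) ∷ [] ≢ (v , zero) ∷ []
    suc≢zero j ()

  Der-concatMap-colourIs : 1 ≤ d → ∀ r → Der (concatMap (colourIs r) (allFin K) ++ constP (- 1#))
  Der-concatMap-colourIs 1≤d (byPair i i′ f) =
    Der-resp (≈P-sym (≈P-++ (concatMap-colourOfPair i i′ f) ≈P-refl)) (Der-pairProducts i i′ (ℕP.*-monoʳ-≤ 2 1≤d))
  Der-concatMap-colourIs 1≤d (constant col) = Der-zero (concatMap-colourConst col)

  CrossVanishes-colourIs-≢ : ∀ r j j′ → j ≢ j′ → CrossVanishes (colourIs r j) (colourIs r j′)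
  CrossVanishes-colourIs-≢ (byPair i i′ f) = CrossVanishes-colourOfPair-≢ i i′ f
  CrossVanishes-colourIs-≢ (constant col) = CrossVanishes-colourConst-≢ col

  Der-square-colourIs : ∀ r j → 4 ≤ 2 ℕ.* d → Der (colourIs r j ⊗ colourIs r j ++ scale (- 1#) (colourIs r j))
  Der-square-colourIs (byPair i i′ f) = Der-square-colourOfPair i i′ f
  Der-square-colourIs (constant col) = Der-square-colourConst col

  Hole : Gad → Fin K → Fin K → Set
  Hole g x y = x ≡ gc g × y ≡ gc′ g

  hole? : ∀ g x y → Hole g x y ⊎ ¬ Hole g x y
  hole? g x y with x ≟F gc g | y ≟F gc′ g
  ... | yes p | yes q = inj₁ (p , q)
  ... | yes _ | no q = inj₂ (q ∘ proj₂)
  ... | no p | _ = inj₂ (p ∘ proj₁)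

  valid⇒sameHole : ∀ g → T (validG g) → gi g ≢ gi′ g × nbr (gi g) (gc g) ≡ nbr (gi′ g) (gc′ g)
  valid⇒sameHole g v with gi g ≟F gi′ g | nbr (gi g) (gc g) ≟F nbr (gi′ g) (gc′ g)
  ... | no ne | yes e = ne , e

  Hole-Conflicting : ∀ g → T (validG g) → ∀ {x y m} → (gi g , x) ∈ m → (gi′ g , y) ∈ m → Hole g x y → Conflicting m
  Hole-Conflicting g v p q (refl , refl) = sameHole-Conflicting p q (proj₁ (valid⇒sameHole g v)) (proj₂ (valid⇒sameHole g v))

  CrossVanishes-gadget : ∀ g → T (validG g) → ∀ f f′ → (∀ x y → ¬ Hole g x y → f x y ≢ f′ x y) → ∀ j →
    CrossVanishes (colourOfPair (gi g) (gi′ g) f j) (colourOfPair (gi g) (gi′ g) f′ j)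
  CrossVanishes-gadget g v f f′ f≢f′ j = CrossVanishes-colourOfPair (gi g) (gi′ g) (gi g) (gi′ g) f f′ j H
    where
    H : ∀ a b a′ b′ → Conflicting ((gi g , a) ∷ (gi′ g , b) ∷ (gi g , a′) ∷ (gi′ g , b′) ∷ []) ⊎ f a b ≢ f′ a′ b′
    H a b a′ b′ with a ≟F a′ | b ≟F b′
    ... | no a≢a′ | _ = inj₁ (repeatedPair-Conflicting _ _ a b a′ b′ (inj₁ a≢a′))
    ... | yes _ | no b≢b′ = inj₁ (repeatedPair-Conflicting _ _ a b a′ b′ (inj₂ b≢b′))
    ... | yes refl | yes refl with hole? g a b
    ...   | inj₁ hole = inj₁ (Hole-Conflicting g v (here refl) (there (here refl)) hole)
    ...   | inj₂ no-hole = inj₂ (f≢f′ a b no-hole)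

  -- r_k is ℓ_k itself when c ≢ c′: then Rv g a = lv g a, which is coloured by colourˡ.
  identified : Gad → Fin K → Bool
  identified g a = isLast a ∧ not (does (gc g ≟F gc′ g))

  colourRv : Bool → Gad → Fin K → Fin K → Fin K → Fin K
  colourRv b g a = if b then G.colourˡ g a else G.colourʳ g a

  rule-Rv : ∀ g a → rule (Rv g a) ≡ byPair (gi g) (gi′ g) (colourRv (identified g a) g a)
  rule-Rv g a with identified g a
  ... | true = refl
  ... | false = refl

  identified⇒ : ∀ g a → identified g a ≡ true → a ≡ last × gc g ≢ gc′ g
  identified⇒ g a e with toℕ a ℕ.≡ᵇ suc (suc n) in a≡last | gc g ≟F gc′ g
  ... | true | no c≢c′ =
    toℕ-injective (PE.trans (ℕP.≡ᵇ⇒≡ (toℕ a) (suc (suc n)) (PE.subst T (PE.sym a≡last) tt)) (PE.sym (toℕ-fromℕ (suc (suc n))))) , c≢c′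
  identified⇒ g a () | true | yes _
  identified⇒ g a () | false | _

  colourRv-≡ : ∀ g a x y → ¬ Hole g x y → colourRv (identified g a) g a x y ≡ G.colourʳ g a x y
  colourRv-≡ g a x y no-hole = go (identified g a) (identified⇒ g a)
    where
    go : ∀ b → (b ≡ true → a ≡ last × gc g ≢ gc′ g) → colourRv b g a x y ≡ G.colourʳ g a x y
    go false _ = refl
    go true h with h refl
    ... | refl , c≢c′ = PE.trans (G.colourˡ-last g x y) (PE.trans (G.lastˡ≡lastʳ g x y c≢c′ no-hole) (PE.sym (G.colourʳ-last g x y)))

  toℕ≡0⇒≡first : ∀ (a : Fin K) → toℕ a ≡ 0 → a ≡ first
  toℕ≡0⇒≡first zero _ = refl

  1≤toℕ⇒≢first : ∀ (a : Fin K) → 1 ≤ toℕ a → a ≢ first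
  1≤toℕ⇒≢first a le refl = ℕP.<-irrefl refl le

  toℕ≤⇒≢last : ∀ (a : Fin K) → toℕ a ≤ suc n → a ≢ last
  toℕ≤⇒≢last a le refl = ℕP.<-irrefl refl (PE.subst (_≤ suc n) (toℕ-fromℕ (suc (suc n))) le)

  colourIs-Rv : ∀ g a j → colourIs (rule (Rv g a)) j ≡ colourOfPair (gi g) (gi′ g) (colourRv (identified g a) g a) j
  colourIs-Rv g a j = PE.cong (λ r → colourIs r j) (rule-Rv g a)

  CrossVanishes-Rvʳ : ∀ {p} g a j → CrossVanishes p (colourOfPair (gi g) (gi′ g) (colourRv (identified g a) g a) j) →
    CrossVanishes p (colourIs (rule (Rv g a)) j)
  CrossVanishes-Rvʳ {p} g a j = PE.subst (CrossVanishes p) (PE.sym (colourIs-Rv g a j))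

  CrossVanishes-Rv : ∀ g a b j → CrossVanishes (colourOfPair (gi g) (gi′ g) (colourRv (identified g a) g a) j)
                                                 (colourOfPair (gi g) (gi′ g) (colourRv (identified g b) g b) j) →
    CrossVanishes (colourIs (rule (Rv g a)) j) (colourIs (rule (Rv g b)) j)
  CrossVanishes-Rv g a b j = PE.subst₂ CrossVanishes (PE.sym (colourIs-Rv g a j)) (PE.sym (colourIs-Rv g b j))

  CrossVanishes-pigeon-ℓ₁ : ∀ g j → CrossVanishes (colourIs (rule (pig (gi g))) j) (colourIs (rule (lv g first)) j)
  CrossVanishes-pigeon-ℓ₁ g j = CrossVanishes-colourOfPair (gi g) (gi g) (gi g) (gi′ g) (λ x _ → x) (G.colourˡ g first) j H
    where
    H : ∀ x y x′ y′ → Conflicting ((gi g , x) ∷ (gi g , y) ∷ (gi g , x′) ∷ (gi′ g , y′) ∷ []) ⊎ x ≢ G.colourˡ g first x′ y′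
    H x y x′ y′ with x ≟F x′
    ... | no x≢x′ = inj₁ (twoHoles-Conflicting _ (here refl) (there (there (here refl))) x≢x′)
    ... | yes refl = inj₂ (G.colourˡ-first g x y′ ∘ PE.sym)

  CrossVanishes-pigeon-r₁ : ∀ g → T (validG g) → ∀ j → CrossVanishes (colourIs (rule (pig (gi′ g))) j) (colourIs (rule (Rv g first)) j)
  CrossVanishes-pigeon-r₁ g v j = CrossVanishes-Rvʳ g first j
    (CrossVanishes-colourOfPair (gi′ g) (gi′ g) (gi g) (gi′ g) (λ y _ → y) (colourRv (identified g first) g first) j H)
    where
    H : ∀ y y₂ x′ y′ → Conflicting ((gi′ g , y) ∷ (gi′ g , y₂) ∷ (gi g , x′) ∷ (gi′ g , y′) ∷ []) ⊎
                       y ≢ colourRv (identified g first) g first x′ y′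
    H y y₂ x′ y′ with y ≟F y′
    ... | no y≢y′ = inj₁ (twoHoles-Conflicting _ (here refl) (there (there (there (here refl)))) y≢y′)
    ... | yes refl with hole? g x′ y
    ...   | inj₁ hole = inj₁ (Hole-Conflicting g v (there (there (here refl))) (there (there (there (here refl)))) hole)
    ...   | inj₂ no-hole = inj₂ λ e → G.colourʳ-first g x′ y (PE.sym (PE.trans e (colourRv-≡ g first x′ y no-hole)))

  CrossVanishes-z-ℓ : ∀ g a (t : Fin M) → 1 ≤ toℕ a → toℕ a ≤ K ℕ.∸ 2 → toℕ t ≡ zIndex (g , L) → ∀ j →
    CrossVanishes (colourIs (rule (zv t)) j) (colourIs (rule (lv g a)) j)
  CrossVanishes-z-ℓ g a t 1≤a a≤ t≡ j =
    CrossVanishes-sym (colourOfPair (gi g) (gi′ g) (G.colourˡ g a) j) _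
      (CrossVanishes-colourOfPair-const (gi g) (gi′ g) (G.colourˡ g a) _ j λ x y →
        inj₂ λ e → G.colourˡ-middle g a x y (1≤toℕ⇒≢first a 1≤a) (toℕ≤⇒≢last a a≤)
                     (PE.trans e (mod-+-* K (gc g) (rank (g , L)) (toℕ t) t≡)))

  CrossVanishes-z-r : ∀ g a (t : Fin M) → T (validG g) → 1 ≤ toℕ a → toℕ a ≤ K ℕ.∸ 2 → toℕ t ≡ zIndex (g , R) → ∀ j →
    CrossVanishes (colourIs (rule (zv t)) j) (colourIs (rule (Rv g a)) j)
  CrossVanishes-z-r g a t v 1≤a a≤ t≡ j = CrossVanishes-Rvʳ g a j
    (CrossVanishes-sym (colourOfPair (gi g) (gi′ g) (colourRv (identified g a) g a) j) _
      (CrossVanishes-colourOfPair-const (gi g) (gi′ g) (colourRv (identified g a) g a) _ j H))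
    where
    H : ∀ x y → Conflicting ((gi g , x) ∷ (gi′ g , y) ∷ []) ⊎ colourRv (identified g a) g a x y ≢ toℕ t mod K
    H x y with hole? g x y
    ... | inj₁ hole = inj₁ (Hole-Conflicting g v (here refl) (there (here refl)) hole)
    ... | inj₂ no-hole = inj₂ λ e → G.colourʳ-middle g a x y (1≤toℕ⇒≢first a 1≤a) (toℕ≤⇒≢last a a≤)
            (PE.trans (PE.sym (colourRv-≡ g a x y no-hole)) (PE.trans e (mod-+-* K (gc′ g) (rank (g , R)) (toℕ t) t≡)))

  CrossVanishes-ℓₖ-rₖ : ∀ g → T (validG g) → gc g ≡ gc′ g → ∀ j →
    CrossVanishes (colourIs (rule (lv g last)) j) (colourIs (rule (Rv g last)) j)
  CrossVanishes-ℓₖ-rₖ g v c≡c′ j = CrossVanishes-Rvʳ g last j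
    (CrossVanishes-gadget g v (G.colourˡ g last) (colourRv (identified g last) g last)
      (λ x y no-hole e → G.lastˡ≢lastʳ g x y c≡c′ no-hole (PE.trans (PE.sym (G.colourˡ-last g x y))
         (PE.trans e (PE.trans (colourRv-≡ g last x y no-hole) (G.colourʳ-last g x y))))) j)

  CrossVanishes-edge : ∀ {p q} → EdgeP p q → ∀ j → CrossVanishes (colourIs (rule p) j) (colourIs (rule q) j)
  CrossVanishes-edge (ℓℓ g a b v a≢b) =
    CrossVanishes-gadget g v (G.colourˡ g a) (G.colourˡ g b) (λ x y _ e → a≢b (G.colourˡ-injective g a b x y e))
  CrossVanishes-edge (rr g a b v a≢b) j = CrossVanishes-Rv g a b j
    (CrossVanishes-gadget g v (colourRv (identified g a) g a) (colourRv (identified g b) g b)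
      (λ x y no-hole e → a≢b (G.colourʳ-injective g a b x y
         (PE.trans (PE.sym (colourRv-≡ g a x y no-hole)) (PE.trans e (colourRv-≡ g b x y no-hole))))) j)
  CrossVanishes-edge (iℓ g a v a≡0) with toℕ≡0⇒≡first a a≡0
  ... | refl = CrossVanishes-pigeon-ℓ₁ g
  CrossVanishes-edge (ir g a v a≡0) with toℕ≡0⇒≡first a a≡0
  ... | refl = CrossVanishes-pigeon-r₁ g v
  CrossVanishes-edge (pℓ g a t v 1≤a a≤ t≡) = CrossVanishes-z-ℓ g a t 1≤a a≤ t≡
  CrossVanishes-edge (pr g a t v 1≤a a≤ t≡) = CrossVanishes-z-r g a t v 1≤a a≤ t≡
  CrossVanishes-edge (ℓr g a v a≡last c≡c′) with toℕ-injective {i = a} {j = last} (PE.trans a≡last (PE.sym (toℕ-fromℕ (suc (suc n)))))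
  ... | refl = CrossVanishes-ℓₖ-rₖ g v c≡c′
  CrossVanishes-edge (zz s t s≢t (w , w≤s , w≤t , s< , t< , _)) j = CrossVanishes-colourConst _ _ j
    (mod-≢-window K w (toℕ s) (toℕ t) w≤s w≤t s< t< (s≢t ∘ toℕ-injective))
  CrossVanishes-edge (symm e) j = CrossVanishes-sym _ _ (CrossVanishes-edge e j)

  open ByDegreeTwo ρ-short
  open Lift (Colouring.KColEq F K _≟V_ Edge) (FPHP.FPHPEq F nbr) d

  Der-σ-colouringAxiom : ∀ {p} → Colouring.KColEq F K _≟V_ Edge p → PX.DegLt (suc d) p → Der (σ p)
  Der-σ-colouringAxiom (Colouring.sumOne v) dg =
    Der-resp (≈P-sym (σ-colourAxiom v)) (Der-concatMap-colourIs (colourAxiom-degree v dg) (rule (proj₁ v)))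
  Der-σ-colouringAxiom (Colouring.atMost v j j′ j≢j′) dg =
    Der-resp (≈P-sym (σ-two (v , j) (v , j′))) (Der-⊗ _ _ (ρ-short (v , j)) (ρ-short (v , j′))
      (ℕP.*-monoʳ-≤ 2 (PX.DegLe-∷ 1# _ [] 1≉0 [] (PX.getD dg))) (CrossVanishes-colourIs-≢ (rule (proj₁ v)) j j′ j≢j′))
  Der-σ-colouringAxiom (Colouring.edge u v j e) dg =
    Der-resp (≈P-sym (σ-two (u , j) (v , j))) (Der-⊗ _ _ (ρ-short (u , j)) (ρ-short (v , j))
      (ℕP.*-monoʳ-≤ 2 (PX.DegLe-∷ 1# _ [] 1≉0 [] (PX.getD dg))) (CrossVanishes-edge e j))

  Der-σ-booleanAxiom : ∀ x → 2 ≤ d → Der (σ (PX.booleanAxiom x))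
  Der-σ-booleanAxiom x@((v , _) , j) 2≤d =
    Der-resp (≈P-sym (σ-booleanAxiom x)) (Der-square-colourIs (rule v) j (ℕP.*-monoʳ-≤ 2 2≤d))

  colouring⇒pigeonhole : KColouringRefutation F K V _≟V_ Edge d → FPHPRefutation F nbr (2 ℕ.* d)
  colouring⇒pigeonhole = σ-Refutation Der-σ-booleanAxiom Der-σ-colouringAxiom

open import Data.Nat using (_*_)
open import Data.Integer using (+_)
open import Data.Rational using (ℚ; 0ℚ; _/_) renaming (_<_ to _<ℚ_; _≤_ to _≤ℚ_; _*_ to _*ℚ_)
open import Function.Definitions using (Injective)

lemma3p5 : ∀ {c ℓ : Level} (F : Field c ℓ)
    (k : ℕ) → 3 ≤ k →
    (C : ℚ) → 0ℚ <ℚ C →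
    (nI nJ : ℕ) (nbr : Fin nI → Fin k → Fin nJ) →
    (∀ i → Injective _≡_ _≡_ (nbr i)) →
    (∀ j → (+ rightDegree nbr j) / 1 ≤ℚ C *ℚ ((+ k) / 1)) →
    (M : ℕ) (key : GadgetIndex.PV nI k → ℕ) →
    Injective _≡_ _≡_ key →
    Construction.Enough k nI nJ nbr M key →
    (d : ℕ) →
    KColouringRefutation F k (Construction.V k nI nJ nbr M key)
    (Construction._≟V_ k nI nJ nbr M key) (Construction.Edge k nI nJ nbr M key) d →
    FPHPRefutation F nbr (2 * d)
lemma3p5 F _ (s≤s (s≤s (s≤s {n = n} z≤n))) C _ nI nJ nbr _ _ M key _ _ d =
  Reduction.colouring⇒pigeonhole F n nI nJ nbr M key d
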